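{- Define the power series in $\mathbb{Q}[x][[t]]$ \[ g_{\mathbb{A}}=1+\sum_{n\ge1}\left(\sum_{i=1}^{\lfloor n/2\rfloor}\frac{\binom{n}{i}\binom{n-i-1}{i-1}}{n-i+1}x^i\right)t^n,\qquad g_{\mathbb{B}}=1+\sum_{n\ge1}\left(\sum_{i=1}^{\lfloor n/2\rfloor}\binom{n}{i}\binom{n-i-1}{i-1}x^i\right)t^n, \] \[ g_{\mathbb{D}}=\sum_{n\ge0}\left(\sum_{i=1}^{\lfloor n/2\rfloor}\frac{(n-2)\binom{2i-2}{i-1}\binom{n-2}{2i-2}}{i}x^i\right)t^n. \] Then $g_{\mathbb{B}}-1=2(g_{\mathbb{A}}-1)+g_{\mathbb{A}}g_{\mathbb{D}}$. -}

module Defs where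

open import Data.Nat using (ℕ; zero; suc; _∸_; _≤ᵇ_) renaming (_*_ to _*ℕ_; _/_ to _/ℕ_)
open import Data.Nat.Combinatorics using (_C_)
open import Data.Integer using (+_)
open import Data.Rational using (ℚ; 0ℚ; 1ℚ; _+_; _*_; _-_; _/_)
open import Data.Bool using (if_then_else_)

-- A power series in ℚ[x][[t]] is represented by its coefficient array:
-- S n i = coefficient of t^n x^i.
Series : Set
Series = ℕ → ℕ → ℚ

Σ≤ : ℕ → (ℕ → ℚ) → ℚ
Σ≤ zero    f = f zero
Σ≤ (suc n) f = Σ≤ n f + f (suc n)

one : Series
one zero zero = 1ℚ
one _    _    = 0ℚ

_⊕_ : Series → Series → Series
(f ⊕ g) n i = f n i + g n i

_⊖_ : Series → Series → Series
(f ⊖ g) n i = f n i - g n i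

_·_ : ℚ → Series → Series
(c · f) n i = c * f n i

_⊛_ : Series → Series → Series
(f ⊛ g) n i = Σ≤ n (λ k → Σ≤ i (λ j → f k j * g (n ∸ k) (i ∸ j)))

infixl 6 _⊕_ _⊖_
infixl 7 _·_ _⊛_

gA : Series
gA zero    zero    = 1ℚ
gA zero    (suc j) = 0ℚ
gA (suc m) zero    = 0ℚ
gA (suc m) (suc j) =
  if suc j ≤ᵇ (suc m /ℕ 2)
  then (+ ((suc m C suc j) *ℕ ((suc m ∸ suc j ∸ 1) C j))) / suc (suc m ∸ suc j)
  else 0ℚ

gB : Series
gB zero    zero    = 1ℚ
gB zero    (suc j) = 0ℚ
gB (suc m) zero    = 0ℚ
gB (suc m) (suc j) =
  if suc j ≤ᵇ (suc m /ℕ 2)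
  then (+ ((suc m C suc j) *ℕ ((suc m ∸ suc j ∸ 1) C j))) / 1
  else 0ℚ

-- g_D: Σ_{n≥0} Σ_{i=1}^{⌊n/2⌋} (n-2) C(2i-2,i-1) C(n-2,2i-2)/i x^i t^n
-- (with i = suc j: 2i-2 = 2j, i-1 = j)
gD : Series
gD n zero    = 0ℚ
gD n (suc j) =
  if suc j ≤ᵇ (n /ℕ 2)
  then (+ ((n ∸ 2) *ℕ (((2 *ℕ j) C j) *ℕ ((n ∸ 2) C (2 *ℕ j))))) / suc j
  else 0ℚ

2ℚ : ℚ
2ℚ = (+ 2) / 1

-- Let Q = t + xt², Δ = (1 - t)² - 4xt² and let R = √Δ be the power series with constant term 1.
-- Coefficient comparisons reduce everything to R:  2Q·gA = 1 + t - R,  2gD = 2R - θₜR - (2 - t)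
-- and gB = (1 + θₜ - θₓ) gA, where θₜ = t∂ₜ and θₓ = x∂ₓ; each of these is a binomial identity.
-- That R² = Δ follows from Δ·θₓR = -2xt²R: both R² and Δ solve Δ·θₓf = -4xt²f, whose solutions
-- are determined by their x-free terms.  Finally, (1 - t)θₜR + tR = 2θₓR, and with these relations
-- 8Q·gA·gD and 8Q·(gB - 1 - 2(gA - 1)) reduce to the same expression; multiplication by Q is injective.

module Submission where

open import Defs
open import Data.Nat using (ℕ)
open import Data.Rational using (ℚ)
open import Relation.Binary.PropositionalEquality using (_≡_)

module Binomial where
  open import Data.Nat
  open import Data.Nat.Properties
  open import Data.Nat.Combinatorics
  open import Data.Nat.DivMod using (m/n*n≡m)
  open import Data.Nat.Solver using (module +-*-Solver)
  open +-*-Solver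
  open import Relation.Binary.PropositionalEquality
  open ≡-Reasoning

  C-factorial : ∀ a b → ((a + b) C a) * (a ! * b !) ≡ (a + b) !
  C-factorial a b = begin
    ((a + b) C a) * (a ! * b !)                              ≡⟨ cong₂ _*_ (nCk≡n!/k![n-k]! a≤a+b) (cong (λ c → a ! * c !) (sym (m+n∸m≡n a b))) ⟩
    ((a + b) ! / (a ! * ((a + b) ∸ a) !)) * (a ! * ((a + b) ∸ a) !) ≡⟨ m/n*n≡m (k![n∸k]!∣n! a≤a+b) ⟩
    (a + b) !                                                  ∎
    where
    a≤a+b = m≤m+n a b
    instance _ = a !* (a + b ∸ a) !≢0

  private
    cancel-factorials : ∀ a b {m n} → m * (a ! * b !) ≡ n * (a ! * b !) → m ≡ n
    cancel-factorials a b = *-cancelʳ-≡ _ _ (a ! * b !) {{a !* b !≢0}}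

  C-absorption : ∀ k r → suc k * ((suc k + r) C suc k) ≡ (suc k + r) * ((k + r) C k)
  C-absorption k r = cancel-factorials k r (begin
    suc k * ((suc k + r) C suc k) * (k ! * r !)
      ≡⟨ solve 4 (λ k b f g → (con 1 :+ k) :* b :* (f :* g) := b :* (((con 1 :+ k) :* f) :* g)) refl k ((suc k + r) C suc k) (k !) (r !) ⟩
    ((suc k + r) C suc k) * (suc k ! * r !)
      ≡⟨ C-factorial (suc k) r ⟩
    suc (k + r) * (k + r) !
      ≡⟨ cong (suc (k + r) *_) (C-factorial k r) ⟨
    suc (k + r) * (((k + r) C k) * (k ! * r !))
      ≡⟨ *-assoc (suc (k + r)) ((k + r) C k) (k ! * r !) ⟨
    (suc k + r) * ((k + r) C k) * (k ! * r !) ∎)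

  C-lower-step : ∀ j r → suc j * ((j + r) C suc j) ≡ r * ((j + r) C j)
  C-lower-step j zero rewrite +-identityʳ j | k>n⇒nCk≡0 (n<1+n j) = *-zeroʳ (suc j)
  C-lower-step j (suc r) rewrite +-suc j r = cancel-factorials j r (begin
    suc j * ((suc j + r) C suc j) * (j ! * r !)
      ≡⟨ solve 4 (λ k b f g → (con 1 :+ k) :* b :* (f :* g) := b :* (((con 1 :+ k) :* f) :* g)) refl j ((suc j + r) C suc j) (j !) (r !) ⟩
    ((suc j + r) C suc j) * (suc j ! * r !)
      ≡⟨ C-factorial (suc j) r ⟩
    (suc j + r) !
      ≡⟨ cong _! (+-suc j r) ⟨
    (j + suc r) !
      ≡⟨ C-factorial j (suc r) ⟨
    ((j + suc r) C j) * (j ! * suc r !)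
      ≡⟨ cong (λ z → (z C j) * (j ! * suc r !)) (+-suc j r) ⟩
    ((suc j + r) C j) * (j ! * (suc r * r !))
      ≡⟨ solve 4 (λ r b f g → b :* (f :* ((con 1 :+ r) :* g)) := (con 1 :+ r) :* b :* (f :* g)) refl r ((suc j + r) C j) (j !) (r !) ⟩
    suc r * ((suc (j + r)) C j) * (j ! * r !) ∎)

  C-upper-step : ∀ k r → suc r * ((k + suc r) C k) ≡ (k + suc r) * ((k + r) C k)
  C-upper-step k r = cancel-factorials k r (begin
    suc r * ((k + suc r) C k) * (k ! * r !)
      ≡⟨ solve 4 (λ r b f g → (con 1 :+ r) :* b :* (f :* g) := b :* (f :* ((con 1 :+ r) :* g))) refl r ((k + suc r) C k) (k !) (r !) ⟩
    ((k + suc r) C k) * (k ! * suc r !)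
      ≡⟨ C-factorial k (suc r) ⟩
    (k + suc r) !
      ≡⟨ cong _! (+-suc k r) ⟩
    suc (k + r) * (k + r) !
      ≡⟨ cong₂ _*_ (+-suc k r) (C-factorial k r) ⟨
    (k + suc r) * (((k + r) C k) * (k ! * r !))
      ≡⟨ *-assoc (k + suc r) ((k + r) C k) (k ! * r !) ⟨
    (k + suc r) * ((k + r) C k) * (k ! * r !) ∎)

  C-subset-of-subset : ∀ a b c → ((a + b + c) C (a + b)) * ((a + b) C a) ≡ ((a + (b + c)) C a) * ((b + c) C b)
  C-subset-of-subset a b c = *-cancelʳ-≡ _ _ (a ! * b ! * c !) {{m*n≢0 _ _ {{a !* b !≢0}} {{c !≢0}}}} (begin
    X * Y * (a ! * b ! * c !)
      ≡⟨ solve 5 (λ x y f g h → x :* y :* (f :* g :* h) := x :* ((y :* (f :* g)) :* h)) refl X Y (a !) (b !) (c !) ⟩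
    X * (Y * (a ! * b !) * c !)
      ≡⟨ cong (λ z → X * (z * c !)) (C-factorial a b) ⟩
    X * ((a + b) ! * c !)
      ≡⟨ C-factorial (a + b) c ⟩
    (a + b + c) !
      ≡⟨ cong _! (+-assoc a b c) ⟩
    (a + (b + c)) !
      ≡⟨ C-factorial a (b + c) ⟨
    U * (a ! * (b + c) !)
      ≡⟨ cong (λ z → U * (a ! * z)) (C-factorial b c) ⟨
    U * (a ! * (V * (b ! * c !)))
      ≡⟨ solve 5 (λ x y f g h → x :* (f :* (y :* (g :* h))) := x :* y :* (f :* g :* h)) refl U V (a !) (b !) (c !) ⟩
    U * V * (a ! * b ! * c !) ∎)
    where
    X = (a + b + c) C (a + b)
    Y = (a + b) C a
    U = (a + (b + c)) C a
    V = (b + c) C b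

  central-C-step : ∀ k → suc k * ((suc k + suc k) C suc k) ≡ 2 * suc (2 * k) * ((k + k) C k)
  central-C-step k = *-cancelʳ-≡ _ _ (k ! * suc k !) {{k !* suc k !≢0}} (begin
    suc k * ((suc k + suc k) C suc k) * (k ! * suc k !)
      ≡⟨ solve 4 (λ k b f g → (con 1 :+ k) :* b :* (f :* g) := b :* (((con 1 :+ k) :* f) :* g)) refl k ((suc k + suc k) C suc k) (k !) (suc k !) ⟩
    ((suc k + suc k) C suc k) * (suc k ! * suc k !)
      ≡⟨ C-factorial (suc k) (suc k) ⟩
    suc (k + suc k) * (k + suc k) !
      ≡⟨ cong (λ z → suc z * z !) (+-suc k k) ⟩
    suc (suc (k + k)) * (suc (k + k) * (k + k) !)
      ≡⟨ cong (λ z → suc (suc (k + k)) * (suc (k + k) * z)) (C-factorial k k) ⟨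
    suc (suc (k + k)) * (suc (k + k) * (((k + k) C k) * (k ! * k !)))
      ≡⟨ solve 4 (λ k b f g → (con 2 :+ (k :+ k)) :* ((con 1 :+ (k :+ k)) :* (b :* (f :* g)))
                   := con 2 :* (con 1 :+ con 2 :* k) :* b :* (f :* ((con 1 :+ k) :* g))) refl k ((k + k) C k) (k !) (k !) ⟩
    2 * suc (2 * k) * ((k + k) C k) * (k ! * suc k !) ∎)

  C-second-difference : ∀ m k → (suc (suc m) C suc (suc k)) + (m C suc (suc k)) ≡ 2 * (suc m C suc (suc k)) + (m C k)
  C-second-difference m k = begin
    (suc (suc m) C suc (suc k)) + (m C suc (suc k))
      ≡⟨ cong (_+ (m C suc (suc k))) (trans (sym (nCk+nC[k+1]≡[n+1]C[k+1] (suc m) (suc k)))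
           (cong₂ _+_ (sym (nCk+nC[k+1]≡[n+1]C[k+1] m k)) (sym (nCk+nC[k+1]≡[n+1]C[k+1] m (suc k))))) ⟩
    ((m C k) + (m C suc k)) + ((m C suc k) + (m C suc (suc k))) + (m C suc (suc k))
      ≡⟨ solve 3 (λ a b c → ((a :+ b) :+ (b :+ c)) :+ c := con 2 :* (b :+ c) :+ a) refl (m C k) (m C suc k) (m C suc (suc k)) ⟩
    2 * ((m C suc k) + (m C suc (suc k))) + (m C k)
      ≡⟨ cong (λ z → 2 * z + (m C k)) (nCk+nC[k+1]≡[n+1]C[k+1] m (suc k)) ⟩
    2 * (suc m C suc (suc k)) + (m C k) ∎

  -- With a = suc j and n = 2a + r: the numerator form of gA(n + 1, a + 1) + gA(n, a) = catalan a · C(n, 2a).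
  C-recurrence-of-gA : ∀ j r →
    suc (suc j) * ((suc (suc j + suc j + r) C suc (suc j)) * ((j + r) C suc j) + ((suc j + suc j + r) C suc j) * ((j + r) C j))
    ≡ suc (suc j + r) * (((suc j + suc j) C suc j) * ((suc j + suc j + r) C (suc j + suc j)))
  C-recurrence-of-gA j r = begin
    suc a * (X₁ * Y₁ + X₂ * Y₂)
      ≡⟨ solve 5 (λ a X₁ Y₁ X₂ Y₂ → (con 1 :+ a) :* (X₁ :* Y₁ :+ X₂ :* Y₂)
                   := ((con 1 :+ a) :* X₁) :* Y₁ :+ (con 1 :+ a) :* X₂ :* Y₂) refl a X₁ Y₁ X₂ Y₂ ⟩
    (suc a * X₁) * Y₁ + suc a * X₂ * Y₂
      ≡⟨ cong (λ z → z * Y₁ + suc a * X₂ * Y₂) absorb ⟩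
    suc (a + a + r) * X₂ * Y₁ + suc a * X₂ * Y₂
      ≡⟨ solve 5 (λ j r X₂ Y₁ Y₂ → (con 1 :+ ((con 1 :+ j) :+ (con 1 :+ j) :+ r)) :* X₂ :* Y₁ :+ (con 1 :+ (con 1 :+ j)) :* X₂ :* Y₂
                   := X₂ :* ((con 1 :+ ((con 1 :+ j) :+ r)) :* Y₁ :+ (con 1 :+ j) :* Y₁ :+ (con 1 :+ (con 1 :+ j)) :* Y₂)) refl j r X₂ Y₁ Y₂ ⟩
    X₂ * (suc (a + r) * Y₁ + suc j * Y₁ + suc a * Y₂)
      ≡⟨ cong (λ z → X₂ * (suc (a + r) * Y₁ + z + suc a * Y₂)) (C-lower-step j r) ⟩
    X₂ * (suc (a + r) * Y₁ + r * Y₂ + suc a * Y₂)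
      ≡⟨ solve 5 (λ a r X₂ Y₁ Y₂ → X₂ :* ((con 1 :+ (a :+ r)) :* Y₁ :+ r :* Y₂ :+ (con 1 :+ a) :* Y₂)
                   := (con 1 :+ (a :+ r)) :* (X₂ :* (Y₂ :+ Y₁))) refl a r X₂ Y₁ Y₂ ⟩
    suc (a + r) * (X₂ * (Y₂ + Y₁))
      ≡⟨ cong (suc (a + r) *_) split ⟨
    suc (a + r) * (((a + a) C a) * ((a + a + r) C (a + a))) ∎
    where
    a = suc j
    X₁ = suc (a + a + r) C suc a
    Y₁ = (j + r) C suc j
    X₂ = (a + a + r) C a
    Y₂ = (j + r) C j
    absorb : suc a * X₁ ≡ suc (a + a + r) * X₂
    absorb = subst (λ z → suc a * (suc z C suc a) ≡ suc z * (z C a)) (sym (+-assoc a a r)) (C-absorption a (a + r))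
    split : ((a + a) C a) * ((a + a + r) C (a + a)) ≡ X₂ * (Y₂ + Y₁)
    split = trans (*-comm ((a + a) C a) _) (trans (C-subset-of-subset a a r)
              (cong₂ _*_ (cong (_C a) (sym (+-assoc a a r))) (sym (nCk+nC[k+1]≡[n+1]C[k+1] (j + r) j))))

open Binomial

open import Data.Nat as ℕ using (zero; suc; _∸_; _≤_; _<_; z≤n; s≤s; _≤ᵇ_)
import Data.Nat.Properties as ℕ
import Data.Nat.DivMod as ℕ
open import Data.Nat.Combinatorics using (_C_; k>n⇒nCk≡0; nCn≡1; nC1≡n)
open import Data.Integer as ℤ using (+_)
import Data.Integer.Properties as ℤ
open import Data.Rational using (0ℚ; 1ℚ; _+_; _*_; _-_; -_; _/_; toℚᵘ; fromℚᵘ)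
open import Data.Rational.Properties
import Data.Rational.Unnormalised as ℚᵘ
import Data.Rational.Unnormalised.Properties as ℚᵘ
open import Data.Rational.Solver using (module +-*-Solver)
open +-*-Solver
open import Data.Bool using (true; false; T; if_then_else_)
open import Data.Empty using (⊥-elim)
open import Data.Product using (_×_; _,_; proj₁)
open import Function using (_∘_; id)
open import Relation.Nullary using (yes; no)
open import Relation.Binary.Definitions using (tri<; tri≈; tri>)
open import Relation.Binary.PropositionalEquality hiding (_≗_)
open ≡-Reasoning

ι : ℕ → ℚ
ι n = + n / 1

1/[1+_] : ℕ → ℚ
1/[1+ d ] = + 1 / suc d

private
  /-cross : ∀ x y d e → x ℤ.* + suc e ≡ y ℤ.* + suc d → x / suc d ≡ y / suc e
  /-cross x y d e eq = fromℚᵘ-cong {ℚᵘ.mkℚᵘ x d} {ℚᵘ.mkℚᵘ y e} (ℚᵘ.*≡* eq)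

  toℚᵘ-/ : ∀ x d → toℚᵘ (x / suc d) ℚᵘ.≃ ℚᵘ.mkℚᵘ x d
  toℚᵘ-/ x d = toℚᵘ-fromℚᵘ (ℚᵘ.mkℚᵘ x d)

  /-*-/ : ∀ x y d e → (x / suc d) * (y / suc e) ≡ fromℚᵘ (ℚᵘ.mkℚᵘ x d ℚᵘ.* ℚᵘ.mkℚᵘ y e)
  /-*-/ x y d e = trans (sym (fromℚᵘ-toℚᵘ _))
    (fromℚᵘ-cong (ℚᵘ.≃-trans (toℚᵘ-homo-* (x / suc d) (y / suc e)) (ℚᵘ.*-cong (toℚᵘ-/ x d) (toℚᵘ-/ y e))))

  /-+-/ : ∀ x y d e → (x / suc d) + (y / suc e) ≡ fromℚᵘ (ℚᵘ.mkℚᵘ x d ℚᵘ.+ ℚᵘ.mkℚᵘ y e)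
  /-+-/ x y d e = trans (sym (fromℚᵘ-toℚᵘ _))
    (fromℚᵘ-cong (ℚᵘ.≃-trans (toℚᵘ-homo-+ (x / suc d) (y / suc e)) (ℚᵘ.+-cong (toℚᵘ-/ x d) (toℚᵘ-/ y e))))

ι-+ : ∀ m n → ι (m ℕ.+ n) ≡ ι m + ι n
ι-+ m n = sym (trans (/-+-/ (+ m) (+ n) 0 0) (/-cross (+ m ℤ.* + 1 ℤ.+ + n ℤ.* + 1) (+ (m ℕ.+ n)) 0 0 eq))
  where
  eq : (+ m ℤ.* + 1 ℤ.+ + n ℤ.* + 1) ℤ.* + 1 ≡ + (m ℕ.+ n) ℤ.* + 1
  eq = cong (ℤ._* + 1) (trans (cong₂ ℤ._+_ (ℤ.*-identityʳ (+ m)) (ℤ.*-identityʳ (+ n))) (sym (ℤ.pos-+ m n)))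

ι-* : ∀ m n → ι (m ℕ.* n) ≡ ι m * ι n
ι-* m n = sym (trans (/-*-/ (+ m) (+ n) 0 0) (/-cross (+ m ℤ.* + n) (+ (m ℕ.* n)) 0 0 (cong (ℤ._* + 1) (sym (ℤ.pos-* m n)))))

ι-suc : ∀ n → ι (suc n) ≡ 1ℚ + ι n
ι-suc = ι-+ 1

/-as-* : ∀ a d → + a / suc d ≡ ι a * 1/[1+ d ]
/-as-* a d = sym (trans (/-*-/ (+ a) (+ 1) 0 d) (/-cross (+ a ℤ.* + 1) (+ a) (d ℕ.+ 0) d eq))
  where
  eq : (+ a ℤ.* + 1) ℤ.* + suc d ≡ + a ℤ.* + suc (d ℕ.+ 0)
  eq = cong₂ ℤ._*_ (ℤ.*-identityʳ (+ a)) (cong (λ k → + suc k) (sym (ℕ.+-identityʳ d)))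

ι[1+d]*1/[1+d]≡1 : ∀ d → ι (suc d) * 1/[1+ d ] ≡ 1ℚ
ι[1+d]*1/[1+d]≡1 d = trans (sym (/-as-* (suc d) d)) (/-cross (+ suc d) (+ 1) d 0 (ℤ.*-comm (+ suc d) (+ 1)))

ι*1/[1+]-cross : ∀ a b d e → a ℕ.* suc e ≡ b ℕ.* suc d → ι a * 1/[1+ d ] ≡ ι b * 1/[1+ e ]
ι*1/[1+]-cross a b d e eq = begin
  ι a * 1/[1+ d ]  ≡⟨ /-as-* a d ⟨
  + a / suc d      ≡⟨ /-cross (+ a) (+ b) d e (trans (sym (ℤ.pos-* a (suc e))) (trans (cong +_ eq) (ℤ.pos-* b (suc d)))) ⟩
  + b / suc e      ≡⟨ /-as-* b e ⟩
  ι b * 1/[1+ e ]  ∎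

ι[1+d]*x≡0⇒x≡0 : ∀ d {x} → ι (suc d) * x ≡ 0ℚ → x ≡ 0ℚ
ι[1+d]*x≡0⇒x≡0 d {x} h = begin
  x                             ≡⟨ *-identityˡ x ⟨
  1ℚ * x                        ≡⟨ cong (_* x) (ι[1+d]*1/[1+d]≡1 d) ⟨
  ι (suc d) * 1/[1+ d ] * x     ≡⟨ solve 3 (λ a v x → (a :* v) :* x := v :* (a :* x)) refl (ι (suc d)) 1/[1+ d ] x ⟩
  1/[1+ d ] * (ι (suc d) * x)   ≡⟨ cong (1/[1+ d ] *_) h ⟩
  1/[1+ d ] * 0ℚ                ≡⟨ *-zeroʳ 1/[1+ d ] ⟩
  0ℚ                            ∎

Σ≤-cong : ∀ n {f g : ℕ → ℚ} → (∀ k → k ≤ n → f k ≡ g k) → Σ≤ n f ≡ Σ≤ n g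
Σ≤-cong zero    h = h 0 z≤n
Σ≤-cong (suc n) h = cong₂ _+_ (Σ≤-cong n (λ k k≤n → h k (ℕ.m≤n⇒m≤1+n k≤n))) (h (suc n) ℕ.≤-refl)

Σ≤-zero : ∀ n (f : ℕ → ℚ) → (∀ k → k ≤ n → f k ≡ 0ℚ) → Σ≤ n f ≡ 0ℚ
Σ≤-zero zero    f h = h 0 z≤n
Σ≤-zero (suc n) f h = cong₂ _+_ (Σ≤-zero n f (λ k k≤n → h k (ℕ.m≤n⇒m≤1+n k≤n))) (h (suc n) ℕ.≤-refl)

Σ≤-distrib-+ : ∀ n (f g : ℕ → ℚ) → Σ≤ n (λ k → f k + g k) ≡ Σ≤ n f + Σ≤ n g
Σ≤-distrib-+ zero    f g = refl
Σ≤-distrib-+ (suc n) f g = trans (cong (_+ (f (suc n) + g (suc n))) (Σ≤-distrib-+ n f g))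
  (solve 4 (λ a b c d → (a :+ b) :+ (c :+ d) := (a :+ c) :+ (b :+ d)) refl (Σ≤ n f) (Σ≤ n g) (f (suc n)) (g (suc n)))

Σ≤-distrib-minus : ∀ n (f g : ℕ → ℚ) → Σ≤ n (λ k → f k - g k) ≡ Σ≤ n f - Σ≤ n g
Σ≤-distrib-minus zero    f g = refl
Σ≤-distrib-minus (suc n) f g = trans (cong (_+ (f (suc n) - g (suc n))) (Σ≤-distrib-minus n f g))
  (solve 4 (λ a b c d → (a :- b) :+ (c :- d) := (a :+ c) :- (b :+ d)) refl (Σ≤ n f) (Σ≤ n g) (f (suc n)) (g (suc n)))

Σ≤-*ˡ : ∀ n c (f : ℕ → ℚ) → Σ≤ n (λ k → c * f k) ≡ c * Σ≤ n f
Σ≤-*ˡ zero    c f = refl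
Σ≤-*ˡ (suc n) c f = trans (cong (_+ (c * f (suc n))) (Σ≤-*ˡ n c f)) (sym (*-distribˡ-+ c (Σ≤ n f) (f (suc n))))

Σ≤-head : ∀ n (f : ℕ → ℚ) → Σ≤ (suc n) f ≡ f 0 + Σ≤ n (f ∘ suc)
Σ≤-head zero    f = refl
Σ≤-head (suc n) f = trans (cong (_+ f (suc (suc n))) (Σ≤-head n f)) (+-assoc (f 0) _ _)

Σ≤-reverse : ∀ n (f : ℕ → ℚ) → Σ≤ n f ≡ Σ≤ n (λ k → f (n ∸ k))
Σ≤-reverse zero    f = refl
Σ≤-reverse (suc n) f = begin
  Σ≤ n f + f (suc n)                         ≡⟨ cong (_+ f (suc n)) (Σ≤-reverse n f) ⟩
  Σ≤ n (λ k → f (n ∸ k)) + f (suc n)         ≡⟨ +-comm _ (f (suc n)) ⟩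
  f (suc n) + Σ≤ n (λ k → f (n ∸ k))         ≡⟨ Σ≤-head n (λ k → f (suc n ∸ k)) ⟨
  Σ≤ (suc n) (λ k → f (suc n ∸ k))           ∎

-- Power series

infix 4 _≗_
_≗_ : Series → Series → Set
f ≗ g = ∀ n i → f n i ≡ g n i

≗-sym : ∀ {f g} → f ≗ g → g ≗ f
≗-sym p n i = sym (p n i)

≗-trans : ∀ {f g h} → f ≗ g → g ≗ h → f ≗ h
≗-trans p q n i = trans (p n i) (q n i)

infixr 9 t⊛_ x⊛_

t⊛_ : Series → Series
(t⊛ f) zero    i = 0ℚ
(t⊛ f) (suc n) i = f n i

x⊛_ : Series → Series
(x⊛ f) n zero    = 0ℚ
(x⊛ f) n (suc i) = f n i

θ[_] : (ℕ → ℕ → ℕ) → Series → Series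
θ[ w ] f n i = ι (w n i) * f n i

θₜ θₓ : Series → Series
θₜ = θ[ (λ n i → n) ]
θₓ = θ[ (λ n i → i) ]

⊛-comm : ∀ f g → f ⊛ g ≗ g ⊛ f
⊛-comm f g n i = trans (Σ≤-reverse n _) (Σ≤-cong n λ k k≤n → trans (Σ≤-reverse i _) (Σ≤-cong i λ j j≤i →
  trans (*-comm (f (n ∸ k) (i ∸ j)) _) (cong₂ (λ a b → g a b * f (n ∸ k) (i ∸ j)) (ℕ.m∸[m∸n]≡n k≤n) (ℕ.m∸[m∸n]≡n j≤i))))

⊛-congˡ : ∀ {f f′} h → f ≗ f′ → f ⊛ h ≗ f′ ⊛ h
⊛-congˡ h p n i = Σ≤-cong n λ k _ → Σ≤-cong i λ j _ → cong (_* h (n ∸ k) (i ∸ j)) (p k j)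

⊛-congʳ : ∀ f {g g′} → g ≗ g′ → f ⊛ g ≗ f ⊛ g′
⊛-congʳ f {g} {g′} p n i = trans (⊛-comm f g n i) (trans (⊛-congˡ f p n i) (⊛-comm g′ f n i))

⊛-distribʳ-⊕ : ∀ f g h → (f ⊕ g) ⊛ h ≗ f ⊛ h ⊕ g ⊛ h
⊛-distribʳ-⊕ f g h n i = trans
  (Σ≤-cong n λ k _ → trans (Σ≤-cong i λ j _ → *-distribʳ-+ (h (n ∸ k) (i ∸ j)) (f k j) (g k j)) (Σ≤-distrib-+ i _ _))
  (Σ≤-distrib-+ n _ _)

⊛-distribʳ-⊖ : ∀ f g h → (f ⊖ g) ⊛ h ≗ f ⊛ h ⊖ g ⊛ h
⊛-distribʳ-⊖ f g h n i = trans
  (Σ≤-cong n λ k _ → trans (Σ≤-cong i λ j _ → solve 3 (λ a b c → (a :- b) :* c := a :* c :- b :* c) refl (f k j) (g k j) (h (n ∸ k) (i ∸ j)))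
    (Σ≤-distrib-minus i _ _))
  (Σ≤-distrib-minus n _ _)

⊛-·ˡ : ∀ c f g → (c · f) ⊛ g ≗ c · (f ⊛ g)
⊛-·ˡ c f g n i = trans (Σ≤-cong n λ k _ → trans (Σ≤-cong i λ j _ → *-assoc c (f k j) (g (n ∸ k) (i ∸ j))) (Σ≤-*ˡ i c _)) (Σ≤-*ˡ n c _)

⊛-·ʳ : ∀ c f g → f ⊛ (c · g) ≗ c · (f ⊛ g)
⊛-·ʳ c f g n i = trans (⊛-comm f (c · g) n i) (trans (⊛-·ˡ c g f n i) (cong (c *_) (⊛-comm g f n i)))

⊛-t⊛ˡ : ∀ f g → (t⊛ f) ⊛ g ≗ t⊛ (f ⊛ g)
⊛-t⊛ˡ f g zero    i = Σ≤-zero i _ λ j _ → *-zeroˡ (g 0 (i ∸ j))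
⊛-t⊛ˡ f g (suc n) i = begin
  Σ≤ (suc n) (λ k → Σ≤ i (λ j → (t⊛ f) k j * g (suc n ∸ k) (i ∸ j)))  ≡⟨ Σ≤-head n _ ⟩
  Σ≤ i (λ j → 0ℚ * g (suc n) (i ∸ j)) + (f ⊛ g) n i                  ≡⟨ cong (_+ (f ⊛ g) n i) (Σ≤-zero i _ λ j _ → *-zeroˡ (g (suc n) (i ∸ j))) ⟩
  0ℚ + (f ⊛ g) n i                                                   ≡⟨ +-identityˡ _ ⟩
  (f ⊛ g) n i                                                        ∎

⊛-x⊛ˡ : ∀ f g → (x⊛ f) ⊛ g ≗ x⊛ (f ⊛ g)
⊛-x⊛ˡ f g n zero    = Σ≤-zero n _ λ k _ → *-zeroˡ (g (n ∸ k) 0)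
⊛-x⊛ˡ f g n (suc i) = Σ≤-cong n λ k _ → begin
  Σ≤ (suc i) (λ j → (x⊛ f) k j * g (n ∸ k) (suc i ∸ j))        ≡⟨ Σ≤-head i _ ⟩
  0ℚ * g (n ∸ k) (suc i) + Σ≤ i (λ j → f k j * g (n ∸ k) (i ∸ j)) ≡⟨ cong (_+ Σ≤ i (λ j → f k j * g (n ∸ k) (i ∸ j))) (*-zeroˡ (g (n ∸ k) (suc i))) ⟩
  0ℚ + Σ≤ i (λ j → f k j * g (n ∸ k) (i ∸ j))                     ≡⟨ +-identityˡ _ ⟩
  Σ≤ i (λ j → f k j * g (n ∸ k) (i ∸ j))                          ∎

private
  Σ≤-one-row : ∀ i (h : ℕ → ℚ) → Σ≤ i (λ j → one 0 j * h (i ∸ j)) ≡ h i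
  Σ≤-one-row zero    h = *-identityˡ (h 0)
  Σ≤-one-row (suc i) h = begin
    Σ≤ (suc i) (λ j → one 0 j * h (suc i ∸ j))      ≡⟨ Σ≤-head i _ ⟩
    1ℚ * h (suc i) + Σ≤ i (λ j → 0ℚ * h (i ∸ j))    ≡⟨ cong₂ _+_ (*-identityˡ (h (suc i))) (Σ≤-zero i _ λ j _ → *-zeroˡ (h (i ∸ j))) ⟩
    h (suc i) + 0ℚ                                  ≡⟨ +-identityʳ (h (suc i)) ⟩
    h (suc i)                                       ∎

⊛-identityˡ : ∀ g → one ⊛ g ≗ g
⊛-identityˡ g zero    i = Σ≤-one-row i (g 0)
⊛-identityˡ g (suc n) i = begin
  (one ⊛ g) (suc n) i
    ≡⟨ Σ≤-head n _ ⟩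
  Σ≤ i (λ j → one 0 j * g (suc n) (i ∸ j)) + Σ≤ n (λ k → Σ≤ i (λ j → 0ℚ * g (n ∸ k) (i ∸ j)))
    ≡⟨ cong₂ _+_ (Σ≤-one-row i (g (suc n))) (Σ≤-zero n _ λ k _ → Σ≤-zero i _ λ j _ → *-zeroˡ (g (n ∸ k) (i ∸ j))) ⟩
  g (suc n) i + 0ℚ
    ≡⟨ +-identityʳ (g (suc n) i) ⟩
  g (suc n) i ∎

⊛-distribˡ-⊖ : ∀ f g h → f ⊛ (g ⊖ h) ≗ f ⊛ g ⊖ f ⊛ h
⊛-distribˡ-⊖ f g h n i = trans (⊛-comm f (g ⊖ h) n i) (trans (⊛-distribʳ-⊖ g h f n i) (cong₂ _-_ (⊛-comm g f n i) (⊛-comm h f n i)))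

⊛-identityʳ : ∀ f → f ⊛ one ≗ f
⊛-identityʳ f n i = trans (⊛-comm f one n i) (⊛-identityˡ f n i)

Additive : (ℕ → ℕ → ℕ) → Set
Additive w = ∀ {n i k j} → k ≤ n → j ≤ i → w n i ≡ w k j ℕ.+ w (n ∸ k) (i ∸ j)

θ-leibniz : ∀ {w} → Additive w → ∀ f g → θ[ w ] (f ⊛ g) ≗ θ[ w ] f ⊛ g ⊕ f ⊛ θ[ w ] g
θ-leibniz {w} additive f g n i = begin
  ι (w n i) * (f ⊛ g) n i
    ≡⟨ Σ≤-*ˡ n (ι (w n i)) (λ k → Σ≤ i (λ j → f k j * g (n ∸ k) (i ∸ j))) ⟨
  Σ≤ n (λ k → ι (w n i) * Σ≤ i (λ j → f k j * g (n ∸ k) (i ∸ j)))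
    ≡⟨ (Σ≤-cong n λ k k≤n → trans (sym (Σ≤-*ˡ i (ι (w n i)) (λ j → f k j * g (n ∸ k) (i ∸ j))))
         (trans (Σ≤-cong i λ j j≤i → split k≤n j≤i) (Σ≤-distrib-+ i _ _))) ⟩
  Σ≤ n (λ k → Σ≤ i (λ j → ι (w k j) * f k j * g (n ∸ k) (i ∸ j)) + Σ≤ i (λ j → f k j * (ι (w (n ∸ k) (i ∸ j)) * g (n ∸ k) (i ∸ j))))
    ≡⟨ Σ≤-distrib-+ n _ _ ⟩
  (θ[ w ] f ⊛ g ⊕ f ⊛ θ[ w ] g) n i ∎
  where
  split : ∀ {k j} → k ≤ n → j ≤ i → ι (w n i) * (f k j * g (n ∸ k) (i ∸ j))
                                   ≡ ι (w k j) * f k j * g (n ∸ k) (i ∸ j) + f k j * (ι (w (n ∸ k) (i ∸ j)) * g (n ∸ k) (i ∸ j))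
  split {k} {j} k≤n j≤i = trans (cong (λ a → ι a * (f k j * g (n ∸ k) (i ∸ j))) (additive k≤n j≤i))
    (trans (cong (_* (f k j * g (n ∸ k) (i ∸ j))) (ι-+ (w k j) (w (n ∸ k) (i ∸ j))))
    (solve 4 (λ a b x y → (a :+ b) :* (x :* y) := a :* x :* y :+ x :* (b :* y)) refl (ι (w k j)) (ι (w (n ∸ k) (i ∸ j))) (f k j) (g (n ∸ k) (i ∸ j))))

θ-⊛-square : ∀ {w} → Additive w → ∀ f → θ[ w ] (f ⊛ f) ≗ 2ℚ · (f ⊛ θ[ w ] f)
θ-⊛-square {w} additive f n i = trans (θ-leibniz additive f f n i) (trans (cong (_+ (f ⊛ θ[ w ] f) n i) (⊛-comm (θ[ w ] f) f n i))
  (solve 1 (λ a → a :+ a := con 2ℚ :* a) refl ((f ⊛ θ[ w ] f) n i)))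

θₜ-additive : Additive (λ n i → n)
θₜ-additive k≤n _ = sym (ℕ.m+[n∸m]≡n k≤n)

θₓ-additive : Additive (λ n i → i)
θₓ-additive _ j≤i = sym (ℕ.m+[n∸m]≡n j≤i)

-- Multiplication by a fixed polynomial.
record Multiplier (L : Series → Series) : Set where
  field
    ≗-homo : ∀ {f g} → f ≗ g → L f ≗ L g
    ⊕-homo : ∀ f g → L (f ⊕ g) ≗ L f ⊕ L g
    ⊖-homo : ∀ f g → L (f ⊖ g) ≗ L f ⊖ L g
    ·-homo : ∀ c f → L (c · f) ≗ c · L f
    ⊛-homo : ∀ f g → L f ⊛ g ≗ L (f ⊛ g)

  ⊛-homoʳ : ∀ f g → f ⊛ L g ≗ L (f ⊛ g)
  ⊛-homoʳ f g n i = trans (⊛-comm f (L g) n i) (trans (⊛-homo g f n i) (≗-homo (⊛-comm g f) n i))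

open Multiplier

id-multiplier : Multiplier id
id-multiplier = record
  { ≗-homo = id
  ; ⊕-homo = λ _ _ _ _ → refl
  ; ⊖-homo = λ _ _ _ _ → refl
  ; ·-homo = λ _ _ _ _ → refl
  ; ⊛-homo = λ _ _ _ _ → refl
  }

t⊛-multiplier : Multiplier t⊛_
t⊛-multiplier = record
  { ≗-homo = λ { p zero i → refl ; p (suc n) i → p n i }
  ; ⊕-homo = λ { f g zero i → refl ; f g (suc n) i → refl }
  ; ⊖-homo = λ { f g zero i → refl ; f g (suc n) i → refl }
  ; ·-homo = λ { c f zero i → sym (*-zeroʳ c) ; c f (suc n) i → refl }
  ; ⊛-homo = ⊛-t⊛ˡ
  }

x⊛-multiplier : Multiplier x⊛_
x⊛-multiplier = record
  { ≗-homo = λ { p n zero → refl ; p n (suc i) → p n i }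
  ; ⊕-homo = λ { f g n zero → refl ; f g n (suc i) → refl }
  ; ⊖-homo = λ { f g n zero → refl ; f g n (suc i) → refl }
  ; ·-homo = λ { c f n zero → sym (*-zeroʳ c) ; c f n (suc i) → refl }
  ; ⊛-homo = ⊛-x⊛ˡ
  }

∘-multiplier : ∀ {L M} → Multiplier L → Multiplier M → Multiplier (L ∘ M)
∘-multiplier {L} {M} ℒ ℳ = record
  { ≗-homo = λ p → ≗-homo ℒ (≗-homo ℳ p)
  ; ⊕-homo = λ f g → ≗-trans (≗-homo ℒ (⊕-homo ℳ f g)) (⊕-homo ℒ (M f) (M g))
  ; ⊖-homo = λ f g → ≗-trans (≗-homo ℒ (⊖-homo ℳ f g)) (⊖-homo ℒ (M f) (M g))
  ; ·-homo = λ c f → ≗-trans (≗-homo ℒ (·-homo ℳ c f)) (·-homo ℒ c (M f))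
  ; ⊛-homo = λ f g → ≗-trans (⊛-homo ℒ (M f) g) (≗-homo ℒ (⊛-homo ℳ f g))
  }

infixl 6 _⊞_ _⊟_
infixl 7 _⊡_

_⊞_ _⊟_ : (Series → Series) → (Series → Series) → Series → Series
(L ⊞ M) f = L f ⊕ M f
(L ⊟ M) f = L f ⊖ M f

_⊡_ : ℚ → (Series → Series) → Series → Series
(c ⊡ L) f = c · L f

⊞-multiplier : ∀ {L M} → Multiplier L → Multiplier M → Multiplier (L ⊞ M)
⊞-multiplier {L} {M} ℒ ℳ = record
  { ≗-homo = λ p n i → cong₂ _+_ (≗-homo ℒ p n i) (≗-homo ℳ p n i)
  ; ⊕-homo = λ f g n i → trans (cong₂ _+_ (⊕-homo ℒ f g n i) (⊕-homo ℳ f g n i))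
      (solve 4 (λ a b c d → (a :+ b) :+ (c :+ d) := (a :+ c) :+ (b :+ d)) refl (L f n i) (L g n i) (M f n i) (M g n i))
  ; ⊖-homo = λ f g n i → trans (cong₂ _+_ (⊖-homo ℒ f g n i) (⊖-homo ℳ f g n i))
      (solve 4 (λ a b c d → (a :- b) :+ (c :- d) := (a :+ c) :- (b :+ d)) refl (L f n i) (L g n i) (M f n i) (M g n i))
  ; ·-homo = λ c f n i → trans (cong₂ _+_ (·-homo ℒ c f n i) (·-homo ℳ c f n i)) (sym (*-distribˡ-+ c (L f n i) (M f n i)))
  ; ⊛-homo = λ f g n i → trans (⊛-distribʳ-⊕ (L f) (M f) g n i) (cong₂ _+_ (⊛-homo ℒ f g n i) (⊛-homo ℳ f g n i))
  }

⊟-multiplier : ∀ {L M} → Multiplier L → Multiplier M → Multiplier (L ⊟ M)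
⊟-multiplier {L} {M} ℒ ℳ = record
  { ≗-homo = λ p n i → cong₂ _-_ (≗-homo ℒ p n i) (≗-homo ℳ p n i)
  ; ⊕-homo = λ f g n i → trans (cong₂ _-_ (⊕-homo ℒ f g n i) (⊕-homo ℳ f g n i))
      (solve 4 (λ a b c d → (a :+ b) :- (c :+ d) := (a :- c) :+ (b :- d)) refl (L f n i) (L g n i) (M f n i) (M g n i))
  ; ⊖-homo = λ f g n i → trans (cong₂ _-_ (⊖-homo ℒ f g n i) (⊖-homo ℳ f g n i))
      (solve 4 (λ a b c d → (a :- b) :- (c :- d) := (a :- c) :- (b :- d)) refl (L f n i) (L g n i) (M f n i) (M g n i))
  ; ·-homo = λ c f n i → trans (cong₂ _-_ (·-homo ℒ c f n i) (·-homo ℳ c f n i))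
      (solve 3 (λ c a b → c :* a :- c :* b := c :* (a :- b)) refl c (L f n i) (M f n i))
  ; ⊛-homo = λ f g n i → trans (⊛-distribʳ-⊖ (L f) (M f) g n i) (cong₂ _-_ (⊛-homo ℒ f g n i) (⊛-homo ℳ f g n i))
  }

⊡-multiplier : ∀ c {L} → Multiplier L → Multiplier (c ⊡ L)
⊡-multiplier c {L} ℒ = record
  { ≗-homo = λ p n i → cong (c *_) (≗-homo ℒ p n i)
  ; ⊕-homo = λ f g n i → trans (cong (c *_) (⊕-homo ℒ f g n i)) (*-distribˡ-+ c (L f n i) (L g n i))
  ; ⊖-homo = λ f g n i → trans (cong (c *_) (⊖-homo ℒ f g n i))
      (solve 3 (λ c a b → c :* (a :- b) := c :* a :- c :* b) refl c (L f n i) (L g n i))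
  ; ·-homo = λ d f n i → trans (cong (c *_) (·-homo ℒ d f n i))
      (solve 3 (λ c d a → c :* (d :* a) := d :* (c :* a)) refl c d (L f n i))
  ; ⊛-homo = λ f g n i → trans (⊛-·ˡ c (L f) g n i) (cong (c *_) (⊛-homo ℒ f g n i))
  }

infixr 9 Q⊛_ Δ⊛_

Q⊛_ : Series → Series
Q⊛_ = t⊛_ ⊞ x⊛_ ∘ t⊛_ ∘ t⊛_

Δ⊛_ : Series → Series
Δ⊛_ = (id ⊟ 2ℚ ⊡ t⊛_ ⊞ t⊛_ ∘ t⊛_) ⊟ ι 4 ⊡ x⊛_ ∘ t⊛_ ∘ t⊛_

xt²-multiplier : Multiplier (x⊛_ ∘ t⊛_ ∘ t⊛_)
xt²-multiplier = ∘-multiplier x⊛-multiplier (∘-multiplier t⊛-multiplier t⊛-multiplier)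

Q-multiplier : Multiplier Q⊛_
Q-multiplier = ⊞-multiplier t⊛-multiplier xt²-multiplier

Δ-multiplier : Multiplier Δ⊛_
Δ-multiplier = ⊟-multiplier (⊞-multiplier (⊟-multiplier id-multiplier (⊡-multiplier 2ℚ t⊛-multiplier))
                                          (∘-multiplier t⊛-multiplier t⊛-multiplier))
                            (⊡-multiplier (ι 4) xt²-multiplier)

Δ : Series
Δ = Δ⊛ one

-- Coefficients of gA, gB and gD

data HalfView (j n : ℕ) : Set where
  fits      : ∀ r → n ≡ suc j ℕ.+ suc j ℕ.+ r → HalfView j n
  too-small : n < 2 ℕ.* suc j → HalfView j n

private
  2*[1+j]≡[1+j]+[1+j] : ∀ j → 2 ℕ.* suc j ≡ suc j ℕ.+ suc j
  2*[1+j]≡[1+j]+[1+j] j = cong (suc j ℕ.+_) (ℕ.+-identityʳ (suc j))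

  ≤-half⇒2*≤ : ∀ j n → suc j ≤ n ℕ./ 2 → suc j ℕ.+ suc j ≤ n
  ≤-half⇒2*≤ j n p = ℕ.≤-trans (ℕ.≤-reflexive (trans (sym (2*[1+j]≡[1+j]+[1+j] j)) (ℕ.*-comm 2 (suc j))))
                               (ℕ.≤-trans (ℕ.*-monoˡ-≤ 2 p) (ℕ.m/n*n≤m n 2))

  2*≤⇒≤-half : ∀ j n → suc j ℕ.+ suc j ≤ n → suc j ≤ n ℕ./ 2
  2*≤⇒≤-half j n p = ℕ.≤-trans (ℕ.≤-reflexive (sym (ℕ.m*n/n≡m (suc j) 2)))
                               (ℕ./-monoˡ-≤ 2 (ℕ.≤-trans (ℕ.≤-reflexive (trans (ℕ.*-comm (suc j) 2) (2*[1+j]≡[1+j]+[1+j] j))) p))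

halfView : ∀ j n → HalfView j n
halfView j n with suc j ℕ.+ suc j ℕ.≤? n
... | yes le = fits (n ∸ (suc j ℕ.+ suc j)) (sym (ℕ.m+[n∸m]≡n le))
... | no ¬le = too-small (subst (n <_) (sym (2*[1+j]≡[1+j]+[1+j] j)) (ℕ.≰⇒> ¬le))

fits⇒≤ᵇ-half : ∀ j r → (suc j ≤ᵇ (suc j ℕ.+ suc j ℕ.+ r) ℕ./ 2) ≡ true
fits⇒≤ᵇ-half j r = T⇒≡true (ℕ.≤⇒≤ᵇ (2*≤⇒≤-half j _ (ℕ.m≤m+n (suc j ℕ.+ suc j) r)))
  where
  T⇒≡true : ∀ {b} → T b → b ≡ true
  T⇒≡true {true} _ = refl

too-small⇒≤ᵇ-half : ∀ j n → n < 2 ℕ.* suc j → (suc j ≤ᵇ n ℕ./ 2) ≡ false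
too-small⇒≤ᵇ-half j n lt with suc j ≤ᵇ n ℕ./ 2 in eq
... | false = refl
... | true  = ⊥-elim (ℕ.<⇒≱ lt (subst (_≤ n) (sym (2*[1+j]≡[1+j]+[1+j] j))
                 (≤-half⇒2*≤ j n (ℕ.≤ᵇ⇒≤ (suc j) (n ℕ./ 2) (subst T (sym eq) _)))))

catalan : ℕ → ℚ
catalan j = ι ((2 ℕ.* j) C j) * 1/[1+ j ]

private
  [n-i]≡[j+r]+1 : ∀ j r → (j ℕ.+ suc j ℕ.+ r) ∸ j ≡ suc (j ℕ.+ r)
  [n-i]≡[j+r]+1 j r = trans (cong (_∸ j) (ℕ.+-assoc j (suc j) r)) (ℕ.m+n∸m≡n j (suc j ℕ.+ r))

module _ (j r : ℕ) where
  private
    n = suc j ℕ.+ suc j ℕ.+ r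

  gA-fits : gA n (suc j) ≡ ι ((n C suc j) ℕ.* ((j ℕ.+ r) C j)) * 1/[1+ suc (j ℕ.+ r) ]
  gA-fits = begin
    gA n (suc j)
      ≡⟨ cong (λ b → if b then + ((n C suc j) ℕ.* ((n ∸ suc j ∸ 1) C j)) / suc (n ∸ suc j) else 0ℚ) (fits⇒≤ᵇ-half j r) ⟩
    + ((n C suc j) ℕ.* ((n ∸ suc j ∸ 1) C j)) / suc (n ∸ suc j)
      ≡⟨ /-as-* ((n C suc j) ℕ.* ((n ∸ suc j ∸ 1) C j)) (n ∸ suc j) ⟩
    ι ((n C suc j) ℕ.* ((n ∸ suc j ∸ 1) C j)) * 1/[1+ n ∸ suc j ]
      ≡⟨ cong (λ d → ι ((n C suc j) ℕ.* ((d ∸ 1) C j)) * 1/[1+ d ]) ([n-i]≡[j+r]+1 j r) ⟩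
    ι ((n C suc j) ℕ.* ((j ℕ.+ r) C j)) * 1/[1+ suc (j ℕ.+ r) ] ∎

  gB-fits : gB n (suc j) ≡ ι ((n C suc j) ℕ.* ((j ℕ.+ r) C j))
  gB-fits = begin
    gB n (suc j)
      ≡⟨ cong (λ b → if b then + ((n C suc j) ℕ.* ((n ∸ suc j ∸ 1) C j)) / 1 else 0ℚ) (fits⇒≤ᵇ-half j r) ⟩
    ι ((n C suc j) ℕ.* ((n ∸ suc j ∸ 1) C j))
      ≡⟨ cong (λ d → ι ((n C suc j) ℕ.* ((d ∸ 1) C j))) ([n-i]≡[j+r]+1 j r) ⟩
    ι ((n C suc j) ℕ.* ((j ℕ.+ r) C j)) ∎

gA-too-small : ∀ j n → n < 2 ℕ.* suc j → gA n (suc j) ≡ 0ℚ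
gA-too-small j zero    lt = refl
gA-too-small j (suc m) lt =
  cong (λ b → if b then + ((suc m C suc j) ℕ.* ((suc m ∸ suc j ∸ 1) C j)) / suc (suc m ∸ suc j) else 0ℚ) (too-small⇒≤ᵇ-half j (suc m) lt)

gB-too-small : ∀ j n → n < 2 ℕ.* suc j → gB n (suc j) ≡ 0ℚ
gB-too-small j zero    lt = refl
gB-too-small j (suc m) lt =
  cong (λ b → if b then + ((suc m C suc j) ℕ.* ((suc m ∸ suc j ∸ 1) C j)) / 1 else 0ℚ) (too-small⇒≤ᵇ-half j (suc m) lt)

gD-value : ∀ m j → gD (suc (suc m)) (suc j) ≡ ι m * (catalan j * ι (m C (2 ℕ.* j)))
gD-value m j = by-view (halfView j (suc (suc m)))
  where
  B = (2 ℕ.* j) C j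
  M = m C (2 ℕ.* j)
  then-branch : ℚ
  then-branch = + (m ℕ.* (B ℕ.* M)) / suc j
  by-view : HalfView j (suc (suc m)) → gD (suc (suc m)) (suc j) ≡ ι m * (catalan j * ι M)
  by-view (too-small lt) = begin
    gD (suc (suc m)) (suc j)    ≡⟨ cong (λ b → if b then then-branch else 0ℚ) (too-small⇒≤ᵇ-half j (suc (suc m)) lt) ⟩
    0ℚ                          ≡⟨ solve 2 (λ a c → con 0ℚ := a :* (c :* con 0ℚ)) refl (ι m) (catalan j) ⟩
    ι m * (catalan j * 0ℚ)      ≡⟨ cong (λ c → ι m * (catalan j * ι c)) (k>n⇒nCk≡0 m<2j) ⟨
    ι m * (catalan j * ι M)     ∎
    where
    m<2j : m < 2 ℕ.* j
    m<2j = ℕ.+-cancelˡ-< 2 m (2 ℕ.* j) (subst (suc (suc m) <_) (ℕ.*-distribˡ-+ 2 1 j) lt)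
  by-view (fits r eq) = begin
    gD (suc (suc m)) (suc j)          ≡⟨ cong (λ b → if b then then-branch else 0ℚ) (subst (λ n → (suc j ≤ᵇ n ℕ./ 2) ≡ true) (sym eq) (fits⇒≤ᵇ-half j r)) ⟩
    + (m ℕ.* (B ℕ.* M)) / suc j        ≡⟨ /-as-* (m ℕ.* (B ℕ.* M)) j ⟩
    ι (m ℕ.* (B ℕ.* M)) * 1/[1+ j ]    ≡⟨ cong (_* 1/[1+ j ]) (trans (ι-* m (B ℕ.* M)) (cong (ι m *_) (ι-* B M))) ⟩
    ι m * (ι B * ι M) * 1/[1+ j ]      ≡⟨ solve 4 (λ a b c v → (a :* (b :* c)) :* v := a :* ((b :* v) :* c)) refl (ι m) (ι B) (ι M) 1/[1+ j ] ⟩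
    ι m * (catalan j * ι M)           ∎

-- The series R

-- R is the expansion of √((1 - t)² - 4xt²) = (1 - t) √(1 - 4u), u = xt²/(1 - t)²,
-- using √(1 - 4u) = 1 - 2 Σⱼ catalan j uʲ⁺¹ and (1 - t)^(-2j-1) = Σₘ C(m, 2j) t^(m-2j).
R : Series
R zero          zero    = 1ℚ
R (suc zero)    zero    = - 1ℚ
R (suc (suc m)) zero    = 0ℚ
R zero          (suc j) = 0ℚ
R (suc zero)    (suc j) = 0ℚ
R (suc (suc m)) (suc j) = - (ι 2 * (catalan j * ι (m C (2 ℕ.* j))))

2R-θₜR-[2-t] : Series
2R-θₜR-[2-t] = (2ℚ · R ⊖ θₜ R) ⊖ (2ℚ · one ⊖ t⊛ one)

2gD≗2R-θₜR-[2-t] : 2ℚ · gD ≗ 2R-θₜR-[2-t]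
2gD≗2R-θₜR-[2-t] zero          zero    = refl
2gD≗2R-θₜR-[2-t] (suc zero)    zero    = refl
2gD≗2R-θₜR-[2-t] (suc (suc m)) zero    = solve 1 (λ x → con 2ℚ :* con 0ℚ
                                                   := (con 2ℚ :* con 0ℚ :- x :* con 0ℚ) :- (con 2ℚ :* con 0ℚ :- con 0ℚ)) refl (ι (suc (suc m)))
2gD≗2R-θₜR-[2-t] zero          (suc j) = refl
2gD≗2R-θₜR-[2-t] (suc zero)    (suc j) = refl
2gD≗2R-θₜR-[2-t] (suc (suc m)) (suc j) = begin
  2ℚ * gD (suc (suc m)) (suc j)
    ≡⟨ cong (2ℚ *_) (gD-value m j) ⟩
  2ℚ * (ι m * c)
    ≡⟨ solve 2 (λ a c → con 2ℚ :* (a :* c)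
                 := (con 2ℚ :* (:- (con 2ℚ :* c)) :- (con 2ℚ :+ a) :* (:- (con 2ℚ :* c))) :- (con 2ℚ :* con 0ℚ :- con 0ℚ)) refl (ι m) c ⟩
  (2ℚ * r - (2ℚ + ι m) * r) - (2ℚ * 0ℚ - 0ℚ)
    ≡⟨ cong (λ z → (2ℚ * r - z * r) - (2ℚ * 0ℚ - 0ℚ)) (ι-+ 2 m) ⟨
  (2ℚ * r - ι (suc (suc m)) * r) - (2ℚ * 0ℚ - 0ℚ) ∎
  where
  c = catalan j * ι (m C (2 ℕ.* j))
  r = R (suc (suc m)) (suc j)

gB-fits-via-gA : ∀ j r → let n = suc j ℕ.+ suc j ℕ.+ r in
                 gB n (suc j) ≡ (ι n * gA n (suc j) - ι (suc j) * gA n (suc j)) + gA n (suc j)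
gB-fits-via-gA j r = begin
  gB n (suc j)                                      ≡⟨ gB-fits j r ⟩
  ι N                                               ≡⟨ *-identityʳ (ι N) ⟨
  ι N * 1ℚ                                          ≡⟨ cong (ι N *_) (ι[1+d]*1/[1+d]≡1 (suc (j ℕ.+ r))) ⟨
  ι N * (ι (suc (suc (j ℕ.+ r))) * v)               ≡⟨ cong (λ z → ι N * (z * v)) (ι-suc (suc (j ℕ.+ r))) ⟩
  ι N * ((1ℚ + w) * v)                              ≡⟨ solve 4 (λ a w x v → x :* ((con 1ℚ :+ w) :* v)
                                                                 := ((a :+ w) :* (x :* v) :- a :* (x :* v)) :+ x :* v) refl (ι (suc j)) w (ι N) v ⟩
  ((ι (suc j) + w) * (ι N * v) - ι (suc j) * (ι N * v)) + ι N * v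
                                                    ≡⟨ cong (λ z → (z * (ι N * v) - ι (suc j) * (ι N * v)) + ι N * v) [1+j]+w≡n ⟩
  (ι n * (ι N * v) - ι (suc j) * (ι N * v)) + ι N * v ≡⟨ cong (λ a → (ι n * a - ι (suc j) * a) + a) (gA-fits j r) ⟨
  (ι n * a - ι (suc j) * a) + a                     ∎
  where
  n = suc j ℕ.+ suc j ℕ.+ r
  N = (n C suc j) ℕ.* ((j ℕ.+ r) C j)
  v = 1/[1+ suc (j ℕ.+ r) ]
  w = ι (suc (j ℕ.+ r))
  a = gA n (suc j)
  [1+j]+w≡n : ι (suc j) + w ≡ ι n
  [1+j]+w≡n = trans (sym (ι-+ (suc j) (suc (j ℕ.+ r)))) (cong ι (sym (ℕ.+-assoc (suc j) (suc j) r)))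

gB≗θₜgA-θₓgA+gA : gB ≗ (θₜ gA ⊖ θₓ gA) ⊕ gA
gB≗θₜgA-θₓgA+gA zero    zero    = refl
gB≗θₜgA-θₓgA+gA zero    (suc j) = solve 1 (λ x → con 0ℚ := (con 0ℚ :* con 0ℚ :- x :* con 0ℚ) :+ con 0ℚ) refl (ι (suc j))
gB≗θₜgA-θₓgA+gA (suc m) zero    = solve 1 (λ x → con 0ℚ := (x :* con 0ℚ :- con 0ℚ :* con 0ℚ) :+ con 0ℚ) refl (ι (suc m))
gB≗θₜgA-θₓgA+gA (suc m) (suc j) = by-view (halfView j (suc m))
  where
  by-view : HalfView j (suc m) → gB (suc m) (suc j) ≡ (ι (suc m) * gA (suc m) (suc j) - ι (suc j) * gA (suc m) (suc j)) + gA (suc m) (suc j)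
  by-view (too-small lt) = begin
    gB (suc m) (suc j)                     ≡⟨ gB-too-small j (suc m) lt ⟩
    0ℚ                                     ≡⟨ solve 2 (λ x y → con 0ℚ := (x :* con 0ℚ :- y :* con 0ℚ) :+ con 0ℚ) refl (ι (suc m)) (ι (suc j)) ⟩
    (ι (suc m) * 0ℚ - ι (suc j) * 0ℚ) + 0ℚ ≡⟨ cong (λ a → (ι (suc m) * a - ι (suc j) * a) + a) (gA-too-small j (suc m) lt) ⟨
    (ι (suc m) * gA (suc m) (suc j) - ι (suc j) * gA (suc m) (suc j)) + gA (suc m) (suc j) ∎
  by-view (fits r eq) = subst (λ n → gB n (suc j) ≡ (ι n * gA n (suc j) - ι (suc j) * gA n (suc j)) + gA n (suc j)) (sym eq) (gB-fits-via-gA j r)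

gA-recurrence-diagonal : ∀ j → let M = suc j ℕ.+ suc j ℕ.+ 0 in
                         gA (suc M) (suc (suc j)) + gA M (suc j) ≡ catalan (suc j) * ι (M C (2 ℕ.* suc j))
gA-recurrence-diagonal j = begin
  gA (suc M) (suc (suc j)) + gA M (suc j)             ≡⟨ cong₂ _+_ (gA-too-small (suc j) (suc M) M+1<2[j+2]) (gA-fits j 0) ⟩
  0ℚ + ι ((M C suc j) ℕ.* ((j ℕ.+ 0) C j)) * v         ≡⟨ cong (λ z → 0ℚ + ι z * v) numerator ⟩
  0ℚ + ι ((2 ℕ.* suc j) C suc j) * v                  ≡⟨ cong (λ d → 0ℚ + ι ((2 ℕ.* suc j) C suc j) * 1/[1+ suc d ]) (ℕ.+-identityʳ j) ⟩
  0ℚ + ι ((2 ℕ.* suc j) C suc j) * 1/[1+ suc j ]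
    ≡⟨ solve 2 (λ a v → con 0ℚ :+ a :* v := (a :* v) :* con 1ℚ) refl (ι ((2 ℕ.* suc j) C suc j)) 1/[1+ suc j ] ⟩
  catalan (suc j) * 1ℚ                                ≡⟨ cong (λ c → catalan (suc j) * ι c) (trans (cong (_C (2 ℕ.* suc j)) M≡2[j+1]) (nCn≡1 (2 ℕ.* suc j))) ⟨
  catalan (suc j) * ι (M C (2 ℕ.* suc j))             ∎
  where
  M = suc j ℕ.+ suc j ℕ.+ 0
  v = 1/[1+ suc (j ℕ.+ 0) ]
  M≡2[j+1] : M ≡ 2 ℕ.* suc j
  M≡2[j+1] = trans (ℕ.+-identityʳ (suc j ℕ.+ suc j)) (sym (2*[1+j]≡[1+j]+[1+j] j))
  numerator : (M C suc j) ℕ.* ((j ℕ.+ 0) C j) ≡ (2 ℕ.* suc j) C suc j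
  numerator = begin
    (M C suc j) ℕ.* ((j ℕ.+ 0) C j)          ≡⟨ cong₂ (λ a b → (a C suc j) ℕ.* (b C j)) M≡2[j+1] (ℕ.+-identityʳ j) ⟩
    ((2 ℕ.* suc j) C suc j) ℕ.* (j C j)      ≡⟨ cong (((2 ℕ.* suc j) C suc j) ℕ.*_) (nCn≡1 j) ⟩
    ((2 ℕ.* suc j) C suc j) ℕ.* 1            ≡⟨ ℕ.*-identityʳ ((2 ℕ.* suc j) C suc j) ⟩
    (2 ℕ.* suc j) C suc j                    ∎
  M+1<2[j+2] : suc M < 2 ℕ.* suc (suc j)
  M+1<2[j+2] = subst (suc M <_) (sym (ℕ.*-suc 2 (suc j))) (subst (λ z → suc z < 2 ℕ.+ 2 ℕ.* suc j) (sym M≡2[j+1]) (s≤s (ℕ.n<1+n _)))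

gA-recurrence-interior : ∀ j r → let M = suc j ℕ.+ suc j ℕ.+ suc r in
                         gA (suc M) (suc (suc j)) + gA M (suc j) ≡ catalan (suc j) * ι (M C (2 ℕ.* suc j))
gA-recurrence-interior j r = begin
  gA (suc M) (suc (suc j)) + gA M (suc j)
    ≡⟨ cong₂ _+_ gA[M+1] (gA-fits j (suc r)) ⟩
  ι (X₁ ℕ.* Y₁) * v + ι (X₂ ℕ.* Y₂) * v
    ≡⟨ solve 3 (λ a b v → a :* v :+ b :* v := (a :+ b) :* v) refl (ι (X₁ ℕ.* Y₁)) (ι (X₂ ℕ.* Y₂)) v ⟩
  (ι (X₁ ℕ.* Y₁) + ι (X₂ ℕ.* Y₂)) * v
    ≡⟨ cong (_* v) (ι-+ (X₁ ℕ.* Y₁) (X₂ ℕ.* Y₂)) ⟨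
  ι (X₁ ℕ.* Y₁ ℕ.+ X₂ ℕ.* Y₂) * v
    ≡⟨ ι*1/[1+]-cross (X₁ ℕ.* Y₁ ℕ.+ X₂ ℕ.* Y₂) (B ℕ.* D) (suc (j ℕ.+ suc r)) (suc j) cross ⟩
  ι (B ℕ.* D) * 1/[1+ suc j ]
    ≡⟨ cong (_* 1/[1+ suc j ]) (ι-* B D) ⟩
  ι B * ι D * 1/[1+ suc j ]
    ≡⟨ solve 3 (λ b d u → b :* d :* u := (b :* u) :* d) refl (ι B) (ι D) 1/[1+ suc j ] ⟩
  ι B * 1/[1+ suc j ] * ι D
    ≡⟨ cong₂ (λ a b → ι (a C suc j) * 1/[1+ suc j ] * ι (M C b)) (2*[1+j]≡[1+j]+[1+j] j) (2*[1+j]≡[1+j]+[1+j] j) ⟨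
  catalan (suc j) * ι (M C (2 ℕ.* suc j)) ∎
  where
  M = suc j ℕ.+ suc j ℕ.+ suc r
  X₁ = suc M C suc (suc j)
  Y₁ = (j ℕ.+ suc r) C suc j
  X₂ = M C suc j
  Y₂ = (j ℕ.+ suc r) C j
  B = (suc j ℕ.+ suc j) C suc j
  D = M C (suc j ℕ.+ suc j)
  v = 1/[1+ suc (j ℕ.+ suc r) ]
  M+1≡ : suc M ≡ suc (suc j) ℕ.+ suc (suc j) ℕ.+ r
  M+1≡ = trans (cong suc (ℕ.+-suc (suc j ℕ.+ suc j) r)) (cong (λ z → suc (suc (z ℕ.+ r))) (sym (ℕ.+-suc j (suc j))))
  gA[M+1] : gA (suc M) (suc (suc j)) ≡ ι (X₁ ℕ.* Y₁) * v
  gA[M+1] = trans (subst (λ n → gA n (suc (suc j)) ≡ ι ((n C suc (suc j)) ℕ.* ((suc j ℕ.+ r) C suc j)) * 1/[1+ suc (suc j ℕ.+ r) ]) (sym M+1≡) (gA-fits (suc j) r))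
              (cong (λ b → ι (X₁ ℕ.* (b C suc j)) * 1/[1+ suc b ]) (sym (ℕ.+-suc j r)))
  cross : (X₁ ℕ.* Y₁ ℕ.+ X₂ ℕ.* Y₂) ℕ.* suc (suc j) ≡ (B ℕ.* D) ℕ.* suc (suc (j ℕ.+ suc r))
  cross = trans (ℕ.*-comm (X₁ ℕ.* Y₁ ℕ.+ X₂ ℕ.* Y₂) (suc (suc j)))
          (trans (C-recurrence-of-gA j (suc r)) (ℕ.*-comm (suc (suc (j ℕ.+ suc r))) (B ℕ.* D)))

gA-recurrence : ∀ j M → gA (suc M) (suc (suc j)) + gA M (suc j) ≡ catalan (suc j) * ι (M C (2 ℕ.* suc j))
gA-recurrence j zero = solve 1 (λ c → con 0ℚ :+ con 0ℚ := c :* con 0ℚ) refl (catalan (suc j))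
gA-recurrence j (suc m) = by-view (halfView j (suc m))
  where
  P : ℕ → Set
  P M = gA (suc M) (suc (suc j)) + gA M (suc j) ≡ catalan (suc j) * ι (M C (2 ℕ.* suc j))
  by-view : HalfView j (suc m) → P (suc m)
  by-view (too-small lt) = begin
    gA (suc (suc m)) (suc (suc j)) + gA (suc m) (suc j) ≡⟨ cong₂ _+_ (gA-too-small (suc j) (suc (suc m)) lt′) (gA-too-small j (suc m) lt) ⟩
    0ℚ + 0ℚ                                             ≡⟨ solve 1 (λ c → con 0ℚ :+ con 0ℚ := c :* con 0ℚ) refl (catalan (suc j)) ⟩
    catalan (suc j) * 0ℚ                                ≡⟨ cong (λ c → catalan (suc j) * ι c) (k>n⇒nCk≡0 lt) ⟨
    catalan (suc j) * ι (suc m C (2 ℕ.* suc j))         ∎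
    where
    lt′ : suc (suc m) < 2 ℕ.* suc (suc j)
    lt′ = subst (suc (suc m) <_) (sym (ℕ.*-suc 2 (suc j))) (s≤s (ℕ.m≤n⇒m≤1+n lt))
  by-view (fits zero    eq) = subst P (sym eq) (gA-recurrence-diagonal j)
  by-view (fits (suc r) eq) = subst P (sym eq) (gA-recurrence-interior j r)

1+t-R : Series
1+t-R = (one ⊕ t⊛ one) ⊖ R

2Q⊛gA≗1+t-R : 2ℚ · Q⊛ gA ≗ 1+t-R
2Q⊛gA≗1+t-R zero                zero          = refl
2Q⊛gA≗1+t-R zero                (suc j)       = refl
2Q⊛gA≗1+t-R (suc zero)          zero          = refl
2Q⊛gA≗1+t-R (suc zero)          (suc j)       = refl
2Q⊛gA≗1+t-R (suc (suc m))       zero          = refl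
2Q⊛gA≗1+t-R (suc (suc zero))    (suc zero)    = refl
2Q⊛gA≗1+t-R (suc (suc (suc m))) (suc zero)    = cong (λ z → 2ℚ * (z + 0ℚ)) (begin
  gA (suc (suc m)) 1                                   ≡⟨ gA-fits 0 m ⟩
  ι ((suc (suc m) C 1) ℕ.* (m C 0)) * 1/[1+ suc m ]    ≡⟨ cong (λ z → ι z * 1/[1+ suc m ]) (trans (ℕ.*-identityʳ (suc (suc m) C 1)) (nC1≡n (suc (suc m)))) ⟩
  ι (suc (suc m)) * 1/[1+ suc m ]                      ≡⟨ ι[1+d]*1/[1+d]≡1 (suc m) ⟩
  1ℚ                                                   ∎)
2Q⊛gA≗1+t-R (suc (suc M))       (suc (suc j)) = begin
  2ℚ * (gA (suc M) (suc (suc j)) + gA M (suc j))      ≡⟨ cong (2ℚ *_) (gA-recurrence j M) ⟩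
  2ℚ * (catalan (suc j) * ι (M C (2 ℕ.* suc j)))      ≡⟨ solve 1 (λ c → con 2ℚ :* c
                                                                   := (con 0ℚ :+ con 0ℚ) :- (:- (con 2ℚ :* c))) refl (catalan (suc j) * ι (M C (2 ℕ.* suc j))) ⟩
  (0ℚ + 0ℚ) - R (suc (suc M)) (suc (suc j))           ∎

ι-C-upper-step : ∀ m k → (ι (suc m) - ι k) * ι (suc m C k) ≡ ι (suc m) * ι (m C k)
ι-C-upper-step m k with ℕ.<-cmp (suc m) k
... | tri< m+1<k _ _ rewrite k>n⇒nCk≡0 m+1<k | k>n⇒nCk≡0 (ℕ.<-trans (ℕ.n<1+n m) m+1<k) =
  solve 2 (λ a b → (a :- b) :* con 0ℚ := a :* con 0ℚ) refl (ι (suc m)) (ι k)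
... | tri≈ _ refl _ rewrite k>n⇒nCk≡0 (ℕ.n<1+n m) =
  solve 2 (λ a b → (a :- a) :* b := a :* con 0ℚ) refl (ι (suc m)) (ι (suc m C suc m))
... | tri> _ _ k<m+1 = subst (λ n → (ι (suc n) - ι k) * ι (suc n C k) ≡ ι (suc n) * ι (n C k)) k+r≡m (begin
  (ι (suc (k ℕ.+ r)) - ι k) * ι (suc (k ℕ.+ r) C k) ≡⟨ cong (λ n → (ι n - ι k) * ι (n C k)) (ℕ.+-suc k r) ⟨
  (ι (k ℕ.+ suc r) - ι k) * ι ((k ℕ.+ suc r) C k)   ≡⟨ cong (λ z → (z - ι k) * ι ((k ℕ.+ suc r) C k)) (ι-+ k (suc r)) ⟩
  (ι k + ι (suc r) - ι k) * ι ((k ℕ.+ suc r) C k)   ≡⟨ solve 3 (λ a b c → (a :+ b :- a) :* c := b :* c) refl (ι k) (ι (suc r)) (ι ((k ℕ.+ suc r) C k)) ⟩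
  ι (suc r) * ι ((k ℕ.+ suc r) C k)                 ≡⟨ ι-* (suc r) ((k ℕ.+ suc r) C k) ⟨
  ι (suc r ℕ.* ((k ℕ.+ suc r) C k))                 ≡⟨ cong ι (C-upper-step k r) ⟩
  ι ((k ℕ.+ suc r) ℕ.* ((k ℕ.+ r) C k))             ≡⟨ ι-* (k ℕ.+ suc r) ((k ℕ.+ r) C k) ⟩
  ι (k ℕ.+ suc r) * ι ((k ℕ.+ r) C k)               ≡⟨ cong (λ z → ι z * ι ((k ℕ.+ r) C k)) (ℕ.+-suc k r) ⟩
  ι (suc (k ℕ.+ r)) * ι ((k ℕ.+ r) C k)             ∎)
  where
  r = m ∸ k
  k+r≡m : k ℕ.+ r ≡ m
  k+r≡m = ℕ.m+[n∸m]≡n (ℕ.≤-pred k<m+1)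

[1-t]θₜR+tR≗2θₓR : (θₜ R ⊖ t⊛ θₜ R) ⊕ t⊛ R ≗ 2ℚ · θₓ R
[1-t]θₜR+tR≗2θₓR zero                zero                = refl
[1-t]θₜR+tR≗2θₓR (suc zero)          zero                = refl
[1-t]θₜR+tR≗2θₓR (suc (suc zero))    zero                = refl
[1-t]θₜR+tR≗2θₓR (suc (suc (suc m))) zero                =
  solve 2 (λ x y → (x :* con 0ℚ :- y :* con 0ℚ) :+ con 0ℚ := con 2ℚ :* (con 0ℚ :* con 0ℚ)) refl (ι (3 ℕ.+ m)) (ι (2 ℕ.+ m))
[1-t]θₜR+tR≗2θₓR zero                (suc j)             =
  solve 1 (λ x → (con 0ℚ :* con 0ℚ :- con 0ℚ) :+ con 0ℚ := con 2ℚ :* (x :* con 0ℚ)) refl (ι (suc j))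
[1-t]θₜR+tR≗2θₓR (suc zero)          (suc j)             =
  solve 1 (λ x → (con 1ℚ :* con 0ℚ :- con 0ℚ :* con 0ℚ) :+ con 0ℚ := con 2ℚ :* (x :* con 0ℚ)) refl (ι (suc j))
[1-t]θₜR+tR≗2θₓR (suc (suc zero))    (suc zero)          = refl
[1-t]θₜR+tR≗2θₓR (suc (suc zero))    (suc (suc j))       =
  solve 2 (λ x c → (con 2ℚ :* (:- (con 2ℚ :* (c :* con 0ℚ))) :- con 1ℚ :* con 0ℚ) :+ con 0ℚ := con 2ℚ :* (x :* (:- (con 2ℚ :* (c :* con 0ℚ)))))
    refl (ι (suc (suc j))) (catalan (suc j))
[1-t]θₜR+tR≗2θₓR (suc (suc (suc m))) (suc j)             = begin
  (ι (3 ℕ.+ m) * r₃ - ι (2 ℕ.+ m) * r₂) + r₂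
    ≡⟨ cong₂ (λ a b → (a * r₃ - b * r₂) + r₂) (ι-+ 2 (suc m)) (ι-suc (suc m)) ⟩
  ((ι 2 + x) * r₃ - (1ℚ + x) * r₂) + r₂
    ≡⟨ solve 5 (λ x c b₁ b₀ r₃ → ((con 2ℚ :+ x) :* r₃ :- (con 1ℚ :+ x) :* (:- (con 2ℚ :* (c :* b₀)))) :+ (:- (con 2ℚ :* (c :* b₀)))
                                := (con 2ℚ :+ x) :* r₃ :+ con 2ℚ :* c :* (x :* b₀)) refl x c b₁ b₀ r₃ ⟩
  (ι 2 + x) * r₃ + ι 2 * c * (x * b₀)
    ≡⟨ cong (λ z → (ι 2 + x) * r₃ + ι 2 * c * z) (ι-C-upper-step m (2 ℕ.* j)) ⟨
  (ι 2 + x) * r₃ + ι 2 * c * ((x - ι (2 ℕ.* j)) * b₁)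
    ≡⟨ cong (λ z → (ι 2 + x) * r₃ + ι 2 * c * ((x - z) * b₁)) (ι-* 2 j) ⟩
  (ι 2 + x) * r₃ + ι 2 * c * ((x - ι 2 * ι j) * b₁)
    ≡⟨ solve 4 (λ x y c b₁ → (con 2ℚ :+ x) :* (:- (con 2ℚ :* (c :* b₁))) :+ con 2ℚ :* c :* ((x :- con 2ℚ :* y) :* b₁)
                             := con 2ℚ :* ((con 1ℚ :+ y) :* (:- (con 2ℚ :* (c :* b₁))))) refl x (ι j) c b₁ ⟩
  2ℚ * ((1ℚ + ι j) * r₃)
    ≡⟨ cong (λ z → 2ℚ * (z * r₃)) (ι-suc j) ⟨
  2ℚ * (ι (suc j) * r₃) ∎
  where
  x = ι (suc m)
  c = catalan j
  b₁ = ι (suc m C (2 ℕ.* j))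
  b₀ = ι (m C (2 ℕ.* j))
  r₃ = R (suc (suc (suc m))) (suc j)
  r₂ = R (suc (suc m)) (suc j)

-- R² = Δ

catalan-step : ∀ j → ι (suc (suc j)) * catalan (suc j) ≡ ι 2 * (1ℚ + ι 2 * ι j) * catalan j
catalan-step j = begin
  ι (suc (suc j)) * (ι B′ * 1/[1+ suc j ])  ≡⟨ solve 3 (λ a b c → a :* (b :* c) := b :* (a :* c)) refl (ι (suc (suc j))) (ι B′) 1/[1+ suc j ] ⟩
  ι B′ * (ι (suc (suc j)) * 1/[1+ suc j ])  ≡⟨ cong (ι B′ *_) (ι[1+d]*1/[1+d]≡1 (suc j)) ⟩
  ι B′ * 1/[1+ 0 ]                          ≡⟨ ι*1/[1+]-cross B′ N 0 j cross ⟩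
  ι N * 1/[1+ j ]                           ≡⟨ cong (_* 1/[1+ j ]) ι-N ⟩
  ι 2 * (1ℚ + ι 2 * ι j) * ι B * 1/[1+ j ]  ≡⟨ *-assoc (ι 2 * (1ℚ + ι 2 * ι j)) (ι B) 1/[1+ j ] ⟩
  ι 2 * (1ℚ + ι 2 * ι j) * catalan j        ∎
  where
  B′ = (2 ℕ.* suc j) C suc j
  B = (2 ℕ.* j) C j
  N = 2 ℕ.* suc (2 ℕ.* j) ℕ.* B
  cross : B′ ℕ.* suc j ≡ N ℕ.* 1
  cross = begin
    B′ ℕ.* suc j                        ≡⟨ ℕ.*-comm B′ (suc j) ⟩
    suc j ℕ.* B′                        ≡⟨ cong (λ z → suc j ℕ.* (z C suc j)) (cong (suc j ℕ.+_) (ℕ.+-identityʳ (suc j))) ⟩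
    suc j ℕ.* ((suc j ℕ.+ suc j) C suc j) ≡⟨ central-C-step j ⟩
    2 ℕ.* suc (2 ℕ.* j) ℕ.* ((j ℕ.+ j) C j) ≡⟨ cong (λ z → 2 ℕ.* suc (2 ℕ.* j) ℕ.* (z C j)) (cong (j ℕ.+_) (ℕ.+-identityʳ j)) ⟨
    N                                   ≡⟨ ℕ.*-identityʳ N ⟨
    N ℕ.* 1                             ∎
  ι-N : ι N ≡ ι 2 * (1ℚ + ι 2 * ι j) * ι B
  ι-N = begin
    ι N                                    ≡⟨ ι-* (2 ℕ.* suc (2 ℕ.* j)) B ⟩
    ι (2 ℕ.* suc (2 ℕ.* j)) * ι B          ≡⟨ cong (_* ι B) (ι-* 2 (suc (2 ℕ.* j))) ⟩
    ι 2 * ι (suc (2 ℕ.* j)) * ι B          ≡⟨ cong (λ z → ι 2 * z * ι B) (trans (ι-suc (2 ℕ.* j)) (cong (λ z → 1ℚ + z) (ι-* 2 j))) ⟩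
    ι 2 * (1ℚ + ι 2 * ι j) * ι B           ∎

ι-C-second-difference : ∀ m k → ι (suc (suc m) C suc (suc k)) + ι (m C suc (suc k)) ≡ ι 2 * ι (suc m C suc (suc k)) + ι (m C k)
ι-C-second-difference m k = begin
  ι (suc (suc m) C suc (suc k)) + ι (m C suc (suc k))     ≡⟨ ι-+ (suc (suc m) C suc (suc k)) (m C suc (suc k)) ⟨
  ι ((suc (suc m) C suc (suc k)) ℕ.+ (m C suc (suc k)))   ≡⟨ cong ι (C-second-difference m k) ⟩
  ι (2 ℕ.* (suc m C suc (suc k)) ℕ.+ (m C k))             ≡⟨ ι-+ (2 ℕ.* (suc m C suc (suc k))) (m C k) ⟩
  ι (2 ℕ.* (suc m C suc (suc k))) + ι (m C k)             ≡⟨ cong (_+ ι (m C k)) (ι-* 2 (suc m C suc (suc k))) ⟩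
  ι 2 * ι (suc m C suc (suc k)) + ι (m C k)               ∎

Δ⊛θₓR≗-2xt²R : Δ⊛ θₓ R ≗ (- ι 2) · x⊛ t⊛ t⊛ R
Δ⊛θₓR≗-2xt²R zero                      zero          = refl
Δ⊛θₓR≗-2xt²R (suc zero)                zero          = refl
Δ⊛θₓR≗-2xt²R (suc (suc zero))          zero          = refl
Δ⊛θₓR≗-2xt²R (suc (suc (suc zero)))    zero          = refl
Δ⊛θₓR≗-2xt²R (suc (suc (suc (suc m)))) zero          = refl
Δ⊛θₓR≗-2xt²R zero                      (suc j)       =
  solve 1 (λ x → ((x :* con 0ℚ :- con 2ℚ :* con 0ℚ) :+ con 0ℚ) :- con (ι 4) :* con 0ℚ := :- con (ι 2) :* con 0ℚ) refl (ι (suc j))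
Δ⊛θₓR≗-2xt²R (suc zero)                (suc j)       =
  solve 1 (λ x → ((x :* con 0ℚ :- con 2ℚ :* (x :* con 0ℚ)) :+ con 0ℚ) :- con (ι 4) :* con 0ℚ := :- con (ι 2) :* con 0ℚ) refl (ι (suc j))
Δ⊛θₓR≗-2xt²R (suc (suc zero))          (suc zero)    = refl
Δ⊛θₓR≗-2xt²R (suc (suc (suc zero)))    (suc zero)    = refl
Δ⊛θₓR≗-2xt²R (suc (suc (suc (suc m)))) (suc zero)    = refl
Δ⊛θₓR≗-2xt²R (suc (suc zero))          (suc (suc j)) =
  solve 3 (λ x y c → ((x :* (:- (con (ι 2) :* (c :* con 0ℚ))) :- con 2ℚ :* (x :* con 0ℚ)) :+ x :* con 0ℚ) :- con (ι 4) :* (y :* con 0ℚ)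
            := :- con (ι 2) :* con 0ℚ)
    refl (ι (suc (suc j))) (ι (suc j)) (catalan (suc j))
Δ⊛θₓR≗-2xt²R (suc (suc (suc zero)))    (suc (suc j)) = begin
  ((ι (suc (suc j)) * (- (ι 2 * (c₁ * ι (1 C (2 ℕ.* suc j))))) - 2ℚ * (ι (suc (suc j)) * R 2 (suc (suc j)))) + ι (suc (suc j)) * 0ℚ) - ι 4 * (ι (suc j) * 0ℚ)
    ≡⟨ cong (λ z → ((ι (suc (suc j)) * (- (ι 2 * (c₁ * ι z))) - 2ℚ * (ι (suc (suc j)) * R 2 (suc (suc j)))) + ι (suc (suc j)) * 0ℚ) - ι 4 * (ι (suc j) * 0ℚ))
            (k>n⇒nCk≡0 (subst (1 <_) (sym (ℕ.*-suc 2 j)) (s≤s (s≤s z≤n)))) ⟩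
  ((ι (suc (suc j)) * (- (ι 2 * (c₁ * 0ℚ))) - 2ℚ * (ι (suc (suc j)) * (- (ι 2 * (c₁ * 0ℚ))))) + ι (suc (suc j)) * 0ℚ) - ι 4 * (ι (suc j) * 0ℚ)
    ≡⟨ solve 3 (λ x y c → ((x :* (:- (con (ι 2) :* (c :* con 0ℚ))) :- con 2ℚ :* (x :* (:- (con (ι 2) :* (c :* con 0ℚ))))) :+ x :* con 0ℚ) :- con (ι 4) :* (y :* con 0ℚ)
                           := :- con (ι 2) :* con 0ℚ) refl (ι (suc (suc j))) (ι (suc j)) c₁ ⟩
  (- ι 2) * 0ℚ ∎
  where
  c₁ = catalan (suc j)
Δ⊛θₓR≗-2xt²R (suc (suc (suc (suc m)))) (suc (suc j)) = begin
  ((ι (suc (suc j)) * R₄ - 2ℚ * (ι (suc (suc j)) * R₃)) + ι (suc (suc j)) * R₂) - ι 4 * (ι (suc j) * R₂′)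
    ≡⟨ solve 8 (λ y j₁ c₁ c₀ b₁ b₂ b₃ b₄ →
         ((y :* (:- (con (ι 2) :* (c₁ :* b₁))) :- con 2ℚ :* (y :* (:- (con (ι 2) :* (c₁ :* b₂))))) :+ y :* (:- (con (ι 2) :* (c₁ :* b₃))))
           :- con (ι 4) :* (j₁ :* (:- (con (ι 2) :* (c₀ :* b₄))))
         := :- con (ι 2) :* (y :* c₁) :* ((b₁ :+ b₃) :- con (ι 2) :* b₂) :+ con (ι 8) :* j₁ :* (c₀ :* b₄))
         refl (ι (suc (suc j))) (ι (suc j)) c₁ c₀ b₁ b₂ b₃ b₄ ⟩
  - ι 2 * (ι (suc (suc j)) * c₁) * ((b₁ + b₃) - ι 2 * b₂) + ι 8 * ι (suc j) * (c₀ * b₄)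
    ≡⟨ cong₂ (λ u v → - ι 2 * u * (v - ι 2 * b₂) + ι 8 * ι (suc j) * (c₀ * b₄)) (catalan-step j) second-difference ⟩
  - ι 2 * (ι 2 * (1ℚ + ι 2 * ι j) * c₀) * ((ι 2 * b₂ + b₄) - ι 2 * b₂) + ι 8 * ι (suc j) * (c₀ * b₄)
    ≡⟨ cong (λ u → - ι 2 * (ι 2 * (1ℚ + ι 2 * ι j) * c₀) * ((ι 2 * b₂ + b₄) - ι 2 * b₂) + ι 8 * u * (c₀ * b₄)) (ι-suc j) ⟩
  - ι 2 * (ι 2 * (1ℚ + ι 2 * ι j) * c₀) * ((ι 2 * b₂ + b₄) - ι 2 * b₂) + ι 8 * (1ℚ + ι j) * (c₀ * b₄)
    ≡⟨ solve 4 (λ y c₀ b₂ b₄ → :- con (ι 2) :* (con (ι 2) :* (con 1ℚ :+ con (ι 2) :* y) :* c₀) :* ((con (ι 2) :* b₂ :+ b₄) :- con (ι 2) :* b₂)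
                               :+ con (ι 8) :* (con 1ℚ :+ y) :* (c₀ :* b₄)
                               := :- con (ι 2) :* (:- (con (ι 2) :* (c₀ :* b₄)))) refl (ι j) c₀ b₂ b₄ ⟩
  (- ι 2) * R₂′ ∎
  where
  c₁ = catalan (suc j)
  c₀ = catalan j
  b₁ = ι (suc (suc m) C (2 ℕ.* suc j))
  b₂ = ι (suc m C (2 ℕ.* suc j))
  b₃ = ι (m C (2 ℕ.* suc j))
  b₄ = ι (m C (2 ℕ.* j))
  R₄ = R (suc (suc (suc (suc m)))) (suc (suc j))
  R₃ = R (suc (suc (suc m))) (suc (suc j))
  R₂ = R (suc (suc m)) (suc (suc j))
  R₂′ = R (suc (suc m)) (suc j)
  second-difference : b₁ + b₃ ≡ ι 2 * b₂ + b₄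
  second-difference = subst (λ k → ι (suc (suc m) C k) + ι (m C k) ≡ ι 2 * ι (suc m C k) + ι (m C (2 ℕ.* j)))
                            (sym (ℕ.*-suc 2 j)) (ι-C-second-difference m (2 ℕ.* j))

multipliers-commute : ∀ {L M} → Multiplier L → Multiplier M → L (M one) ≗ M (L one)
multipliers-commute {L} {M} ℒ ℳ n i = begin
  L (M one) n i        ≡⟨ ≗-homo ℒ (≗-sym (⊛-identityˡ (M one))) n i ⟩
  L (one ⊛ M one) n i  ≡⟨ ⊛-homo ℒ one (M one) n i ⟨
  (L one ⊛ M one) n i  ≡⟨ ⊛-comm (L one) (M one) n i ⟩
  (M one ⊛ L one) n i  ≡⟨ ⊛-homo ℳ one (L one) n i ⟩
  M (one ⊛ L one) n i  ≡⟨ ≗-homo ℳ (⊛-identityˡ (L one)) n i ⟩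
  M (L one) n i        ∎

θₓΔ≗-4xt² : θₓ Δ ≗ (- ι 4) · x⊛ t⊛ t⊛ one
θₓΔ≗-4xt² zero                zero                = refl
θₓΔ≗-4xt² (suc zero)          zero                = refl
θₓΔ≗-4xt² (suc (suc zero))    zero                = refl
θₓΔ≗-4xt² (suc (suc (suc n))) zero                = refl
θₓΔ≗-4xt² zero                (suc zero)          = refl
θₓΔ≗-4xt² (suc zero)          (suc zero)          = refl
θₓΔ≗-4xt² (suc (suc zero))    (suc zero)          = refl
θₓΔ≗-4xt² (suc (suc (suc n))) (suc zero)          = refl
θₓΔ≗-4xt² zero                (suc (suc i))       = *-zeroʳ (ι (suc (suc i)))
θₓΔ≗-4xt² (suc zero)          (suc (suc i))       = *-zeroʳ (ι (suc (suc i)))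
θₓΔ≗-4xt² (suc (suc zero))    (suc (suc i))       = *-zeroʳ (ι (suc (suc i)))
θₓΔ≗-4xt² (suc (suc (suc n))) (suc (suc i))       = *-zeroʳ (ι (suc (suc i)))

Δ⊛θₓΔ≗-4xt²Δ : Δ⊛ θₓ Δ ≗ (- ι 4) · x⊛ t⊛ t⊛ Δ
Δ⊛θₓΔ≗-4xt²Δ = ≗-trans (≗-homo Δ-multiplier θₓΔ≗-4xt²)
               (≗-trans (·-homo Δ-multiplier (- ι 4) (x⊛ t⊛ t⊛ one))
               (λ n i → cong ((- ι 4) *_) (multipliers-commute Δ-multiplier xt²-multiplier n i)))

-- At xʲ⁺¹tⁿ the equation expresses (j + 1)·K(n, j + 1) through K(n - 1, j + 1), K(n - 2, j + 1) and K(n - 2, j).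
Δ⊛θₓ-uniqueness : ∀ c K → Δ⊛ θₓ K ≗ c · x⊛ t⊛ t⊛ K → (∀ n → K n 0 ≡ 0ℚ) → ∀ n i → K n i ≡ 0ℚ
Δ⊛θₓ-uniqueness c K ode K[n,0]≡0 n i = K≡0 i n
  where
  leading-term : ∀ {x a b c′ d e} → ((x * a - 2ℚ * b) + c′) - ι 4 * d ≡ c * e → b ≡ 0ℚ → c′ ≡ 0ℚ → d ≡ 0ℚ → e ≡ 0ℚ → x * a ≡ 0ℚ
  leading-term {x} {a} eq refl refl refl refl =
    trans (solve 2 (λ x a → x :* a := ((x :* a :- con 2ℚ :* con 0ℚ) :+ con 0ℚ) :- con (ι 4) :* con 0ℚ) refl x a) (trans eq (*-zeroʳ c))
  scaled : ∀ a {x} → x ≡ 0ℚ → a * x ≡ 0ℚ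
  scaled a refl = *-zeroʳ a
  K≡0 : ∀ i n → K n i ≡ 0ℚ
  K≡0 zero    n = K[n,0]≡0 n
  K≡0 (suc j) n = proj₁ (consecutive n)
    where
    top : ∀ n → ((ι (suc j) * K n (suc j) - 2ℚ * (t⊛ θₓ K) n (suc j)) + (t⊛ t⊛ θₓ K) n (suc j)) - ι 4 * (t⊛ t⊛ θₓ K) n j
              ≡ c * (t⊛ t⊛ K) n j
    top = λ n → ode n (suc j)
    consecutive : ∀ n → K n (suc j) ≡ 0ℚ × K (suc n) (suc j) ≡ 0ℚ
    consecutive zero    = K₀ , K₁
      where
      K₀ = ι[1+d]*x≡0⇒x≡0 j (leading-term {ι (suc j)} {K 0 (suc j)} (top 0) refl refl refl refl)
      K₁ = ι[1+d]*x≡0⇒x≡0 j (leading-term {ι (suc j)} {K 1 (suc j)} (top 1) (scaled (ι (suc j)) K₀) refl refl refl)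
    consecutive (suc n) with consecutive n
    ... | Kₙ , Kₙ₊₁ = Kₙ₊₁ , ι[1+d]*x≡0⇒x≡0 j (leading-term {ι (suc j)} {K (suc (suc n)) (suc j)} (top (suc (suc n)))
                               (scaled (ι (suc j)) Kₙ₊₁) (scaled (ι (suc j)) Kₙ) (scaled (ι j) (K≡0 j n)) (K≡0 j n))

θₓ-⊖ : ∀ f g → θₓ (f ⊖ g) ≗ θₓ f ⊖ θₓ g
θₓ-⊖ f g n i = solve 3 (λ x a b → x :* (a :- b) := x :* a :- x :* b) refl (ι i) (f n i) (g n i)

Δ⊛θₓ-⊖ : ∀ c f g → Δ⊛ θₓ f ≗ c · x⊛ t⊛ t⊛ f → Δ⊛ θₓ g ≗ c · x⊛ t⊛ t⊛ g → Δ⊛ θₓ (f ⊖ g) ≗ c · x⊛ t⊛ t⊛ (f ⊖ g)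
Δ⊛θₓ-⊖ c f g ode-f ode-g n i = begin
  (Δ⊛ θₓ (f ⊖ g)) n i                          ≡⟨ ≗-homo Δ-multiplier (θₓ-⊖ f g) n i ⟩
  (Δ⊛ (θₓ f ⊖ θₓ g)) n i                       ≡⟨ ⊖-homo Δ-multiplier (θₓ f) (θₓ g) n i ⟩
  (Δ⊛ θₓ f) n i - (Δ⊛ θₓ g) n i                ≡⟨ cong₂ _-_ (ode-f n i) (ode-g n i) ⟩
  c * (x⊛ t⊛ t⊛ f) n i - c * (x⊛ t⊛ t⊛ g) n i  ≡⟨ solve 3 (λ c a b → c :* a :- c :* b := c :* (a :- b)) refl c ((x⊛ t⊛ t⊛ f) n i) ((x⊛ t⊛ t⊛ g) n i) ⟩
  c * ((x⊛ t⊛ t⊛ f) n i - (x⊛ t⊛ t⊛ g) n i)    ≡⟨ cong (c *_) (⊖-homo xt²-multiplier f g n i) ⟨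
  c * (x⊛ t⊛ t⊛ (f ⊖ g)) n i                  ∎

Δ⊛θₓR⊛R≗-4xt²R⊛R : Δ⊛ θₓ (R ⊛ R) ≗ (- ι 4) · x⊛ t⊛ t⊛ (R ⊛ R)
Δ⊛θₓR⊛R≗-4xt²R⊛R n i = begin
  (Δ⊛ θₓ (R ⊛ R)) n i                        ≡⟨ ≗-homo Δ-multiplier (θ-⊛-square θₓ-additive R) n i ⟩
  (Δ⊛ (2ℚ · (R ⊛ θₓ R))) n i                 ≡⟨ ·-homo Δ-multiplier 2ℚ (R ⊛ θₓ R) n i ⟩
  2ℚ * (Δ⊛ (R ⊛ θₓ R)) n i                   ≡⟨ cong (2ℚ *_) (⊛-homoʳ Δ-multiplier R (θₓ R) n i) ⟨
  2ℚ * (R ⊛ Δ⊛ θₓ R) n i                     ≡⟨ cong (2ℚ *_) (⊛-congʳ R Δ⊛θₓR≗-2xt²R n i) ⟩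
  2ℚ * (R ⊛ ((- ι 2) · x⊛ t⊛ t⊛ R)) n i       ≡⟨ cong (2ℚ *_) (⊛-·ʳ (- ι 2) R (x⊛ t⊛ t⊛ R) n i) ⟩
  2ℚ * ((- ι 2) * (R ⊛ x⊛ t⊛ t⊛ R) n i)      ≡⟨ cong (λ z → 2ℚ * ((- ι 2) * z)) (⊛-homoʳ xt²-multiplier R R n i) ⟩
  2ℚ * ((- ι 2) * (x⊛ t⊛ t⊛ (R ⊛ R)) n i)    ≡⟨ solve 1 (λ a → con 2ℚ :* (:- con (ι 2) :* a) := :- con (ι 4) :* a) refl ((x⊛ t⊛ t⊛ (R ⊛ R)) n i) ⟩
  (- ι 4) * (x⊛ t⊛ t⊛ (R ⊛ R)) n i           ∎

R⊛R≗Δ : R ⊛ R ≗ Δ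
R⊛R≗Δ n i = begin
  (R ⊛ R) n i                        ≡⟨ solve 2 (λ a b → a := (a :- b) :+ b) refl ((R ⊛ R) n i) (Δ n i) ⟩
  ((R ⊛ R) n i - Δ n i) + Δ n i      ≡⟨ cong (_+ Δ n i) (Δ⊛θₓ-uniqueness (- ι 4) (R ⊛ R ⊖ Δ)
                                          (Δ⊛θₓ-⊖ (- ι 4) (R ⊛ R) Δ Δ⊛θₓR⊛R≗-4xt²R⊛R Δ⊛θₓΔ≗-4xt²Δ) agree-at-x⁰ n i) ⟩
  0ℚ + Δ n i                         ≡⟨ +-identityˡ (Δ n i) ⟩
  Δ n i                              ∎
  where
  R⊛R[n,0] : ∀ n → (R ⊛ R) n 0 ≡ Δ n 0
  R⊛R[n,0] zero                = refl
  R⊛R[n,0] (suc zero)          = refl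
  R⊛R[n,0] (suc (suc zero))    = refl
  R⊛R[n,0] (suc (suc (suc m))) = Σ≤-zero (suc (suc (suc m))) _ vanishing
    where
    vanishing : ∀ k → k ≤ suc (suc (suc m)) → Σ≤ 0 (λ j → R k j * R (suc (suc (suc m)) ∸ k) (0 ∸ j)) ≡ 0ℚ
    vanishing zero          _ = refl
    vanishing (suc zero)    _ = refl
    vanishing (suc (suc k)) _ = *-zeroˡ (R (suc (suc (suc m)) ∸ suc (suc k)) 0)
  agree-at-x⁰ : ∀ n → (R ⊛ R ⊖ Δ) n 0 ≡ 0ℚ
  agree-at-x⁰ n = trans (cong (_- Δ n 0) (R⊛R[n,0] n)) (+-inverseʳ (Δ n 0))

-- Comparison of both sides

Q⊛θₜ : ∀ f → Q⊛ θₜ f ≗ θₜ (Q⊛ f) ⊖ (t⊛ f ⊕ 2ℚ · x⊛ t⊛ t⊛ f)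
Q⊛θₜ f zero          zero    = refl
Q⊛θₜ f zero          (suc i) = refl
Q⊛θₜ f (suc zero)    zero    = solve 1 (λ a → con 0ℚ :* a :+ con 0ℚ := con 1ℚ :* (a :+ con 0ℚ) :- (a :+ con 2ℚ :* con 0ℚ)) refl (f 0 0)
Q⊛θₜ f (suc zero)    (suc i) = solve 1 (λ a → con 0ℚ :* a :+ con 0ℚ := con 1ℚ :* (a :+ con 0ℚ) :- (a :+ con 2ℚ :* con 0ℚ)) refl (f 0 (suc i))
Q⊛θₜ f (suc (suc n)) zero    = begin
  ι (suc n) * f (suc n) 0 + 0ℚ                               ≡⟨ cong (λ x → x * f (suc n) 0 + 0ℚ) (ι-suc n) ⟩
  (1ℚ + ι n) * f (suc n) 0 + 0ℚ                              ≡⟨ solve 2 (λ x a → (con 1ℚ :+ x) :* a :+ con 0ℚ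
                                                                          := (con 2ℚ :+ x) :* (a :+ con 0ℚ) :- (a :+ con 2ℚ :* con 0ℚ)) refl (ι n) (f (suc n) 0) ⟩
  (ι 2 + ι n) * (f (suc n) 0 + 0ℚ) - (f (suc n) 0 + 2ℚ * 0ℚ) ≡⟨ cong (λ x → x * (f (suc n) 0 + 0ℚ) - (f (suc n) 0 + 2ℚ * 0ℚ)) (ι-+ 2 n) ⟨
  ι (2 ℕ.+ n) * (f (suc n) 0 + 0ℚ) - (f (suc n) 0 + 2ℚ * 0ℚ) ∎
Q⊛θₜ f (suc (suc n)) (suc i) = begin
  ι (suc n) * a + ι n * b                   ≡⟨ cong (λ x → x * a + ι n * b) (ι-suc n) ⟩
  (1ℚ + ι n) * a + ι n * b                  ≡⟨ solve 3 (λ x a b → (con 1ℚ :+ x) :* a :+ x :* b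
                                                         := (con 2ℚ :+ x) :* (a :+ b) :- (a :+ con 2ℚ :* b)) refl (ι n) a b ⟩
  (ι 2 + ι n) * (a + b) - (a + 2ℚ * b)      ≡⟨ cong (λ x → x * (a + b) - (a + 2ℚ * b)) (ι-+ 2 n) ⟨
  ι (2 ℕ.+ n) * (a + b) - (a + 2ℚ * b)      ∎
  where
  a = f (suc n) (suc i)
  b = f n i

Q⊛θₓ : ∀ f → Q⊛ θₓ f ≗ θₓ (Q⊛ f) ⊖ x⊛ t⊛ t⊛ f
Q⊛θₓ f zero          zero    = refl
Q⊛θₓ f zero          (suc i) = solve 1 (λ x → con 0ℚ :+ con 0ℚ := x :* (con 0ℚ :+ con 0ℚ) :- con 0ℚ) refl (ι (suc i))
Q⊛θₓ f (suc zero)    zero    = solve 1 (λ a → con 0ℚ :* a :+ con 0ℚ := con 0ℚ :* (a :+ con 0ℚ) :- con 0ℚ) refl (f 0 0)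
Q⊛θₓ f (suc zero)    (suc i) = solve 2 (λ x a → x :* a :+ con 0ℚ := x :* (a :+ con 0ℚ) :- con 0ℚ) refl (ι (suc i)) (f 0 (suc i))
Q⊛θₓ f (suc (suc n)) zero    = solve 1 (λ a → con 0ℚ :* a :+ con 0ℚ := con 0ℚ :* (a :+ con 0ℚ) :- con 0ℚ) refl (f (suc n) 0)
Q⊛θₓ f (suc (suc n)) (suc i) = begin
  ι (suc i) * a + ι i * b                   ≡⟨ cong (λ x → x * a + ι i * b) (ι-suc i) ⟩
  (1ℚ + ι i) * a + ι i * b                  ≡⟨ solve 3 (λ x a b → (con 1ℚ :+ x) :* a :+ x :* b := (con 1ℚ :+ x) :* (a :+ b) :- b) refl (ι i) a b ⟩
  (1ℚ + ι i) * (a + b) - b                  ≡⟨ cong (λ x → x * (a + b) - b) (ι-suc i) ⟨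
  ι (suc i) * (a + b) - b                   ∎
  where
  a = f (suc n) (suc i)
  b = f n i

Q⊛-injective : ∀ f → (∀ n i → (Q⊛ f) n i ≡ 0ℚ) → ∀ n i → f n i ≡ 0ℚ
Q⊛-injective f Q⊛f≡0 zero    i = trans (sym (+-identityʳ (f 0 i))) (trans (cong (λ z → f 0 i + z) (xt²f[1,i] i)) (Q⊛f≡0 1 i))
  where
  xt²f[1,i] : ∀ i → 0ℚ ≡ (x⊛ t⊛ t⊛ f) 1 i
  xt²f[1,i] zero    = refl
  xt²f[1,i] (suc i) = refl
Q⊛-injective f Q⊛f≡0 (suc n) i = trans (sym (+-identityʳ (f (suc n) i))) (trans (cong (λ z → f (suc n) i + z) (xt²f[n+2,i] i)) (Q⊛f≡0 (suc (suc n)) i))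
  where
  xt²f[n+2,i] : ∀ i → 0ℚ ≡ (x⊛ t⊛ t⊛ f) (suc (suc n)) i
  xt²f[n+2,i] zero    = refl
  xt²f[n+2,i] (suc i) = sym (Q⊛-injective f Q⊛f≡0 n i)

1+t-R⊛ : ∀ f → 1+t-R ⊛ f ≗ (f ⊕ t⊛ f) ⊖ R ⊛ f
1+t-R⊛ f n i = begin
  (1+t-R ⊛ f) n i                           ≡⟨ ⊛-distribʳ-⊖ (one ⊕ t⊛ one) R f n i ⟩
  ((one ⊕ t⊛ one) ⊛ f) n i - (R ⊛ f) n i    ≡⟨ cong (_- (R ⊛ f) n i) (⊛-distribʳ-⊕ one (t⊛ one) f n i) ⟩
  ((one ⊛ f) n i + (t⊛ one ⊛ f) n i) - (R ⊛ f) n i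
    ≡⟨ cong (λ z → (z + (t⊛ one ⊛ f) n i) - (R ⊛ f) n i) (⊛-identityˡ f n i) ⟩
  (f n i + (t⊛ one ⊛ f) n i) - (R ⊛ f) n i  ≡⟨ cong (λ z → (f n i + z) - (R ⊛ f) n i) (⊛-homo t⊛-multiplier one f n i) ⟩
  (f n i + (t⊛ (one ⊛ f)) n i) - (R ⊛ f) n i ≡⟨ cong (λ z → (f n i + z) - (R ⊛ f) n i) (≗-homo t⊛-multiplier (⊛-identityˡ f) n i) ⟩
  (f n i + (t⊛ f) n i) - (R ⊛ f) n i        ∎

2R⊛[2R-θₜR-[2-t]] : 2ℚ · (R ⊛ 2R-θₜR-[2-t]) ≗ ((ι 4 · Δ ⊖ θₜ Δ) ⊖ ι 4 · R) ⊕ 2ℚ · t⊛ R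
2R⊛[2R-θₜR-[2-t]] n i = begin
  2ℚ * (R ⊛ 2R-θₜR-[2-t]) n i
    ≡⟨ cong (2ℚ *_) (⊛-distribˡ-⊖ R (2ℚ · R ⊖ θₜ R) (2ℚ · one ⊖ t⊛ one) n i) ⟩
  2ℚ * ((R ⊛ (2ℚ · R ⊖ θₜ R)) n i - (R ⊛ (2ℚ · one ⊖ t⊛ one)) n i)
    ≡⟨ cong₂ (λ a b → 2ℚ * (a - b)) (⊛-distribˡ-⊖ R (2ℚ · R) (θₜ R) n i) (⊛-distribˡ-⊖ R (2ℚ · one) (t⊛ one) n i) ⟩
  2ℚ * (((R ⊛ (2ℚ · R)) n i - (R ⊛ θₜ R) n i) - ((R ⊛ (2ℚ · one)) n i - (R ⊛ t⊛ one) n i))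
    ≡⟨ cong₂ (λ a b → 2ℚ * ((a - (R ⊛ θₜ R) n i) - (b - (R ⊛ t⊛ one) n i))) (⊛-·ʳ 2ℚ R R n i) (⊛-·ʳ 2ℚ R one n i) ⟩
  2ℚ * ((2ℚ * (R ⊛ R) n i - (R ⊛ θₜ R) n i) - (2ℚ * (R ⊛ one) n i - (R ⊛ t⊛ one) n i))
    ≡⟨ cong₂ (λ a b → 2ℚ * ((2ℚ * (R ⊛ R) n i - (R ⊛ θₜ R) n i) - (2ℚ * a - b))) (⊛-identityʳ R n i) R⊛t≗tR ⟩
  2ℚ * ((2ℚ * (R ⊛ R) n i - (R ⊛ θₜ R) n i) - (2ℚ * R n i - (t⊛ R) n i))
    ≡⟨ solve 4 (λ a b r s → con 2ℚ :* ((con 2ℚ :* a :- b) :- (con 2ℚ :* r :- s)) := ((con (ι 4) :* a :- con 2ℚ :* b) :- con (ι 4) :* r) :+ con 2ℚ :* s)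
         refl ((R ⊛ R) n i) ((R ⊛ θₜ R) n i) (R n i) ((t⊛ R) n i) ⟩
  ((ι 4 * (R ⊛ R) n i - 2ℚ * (R ⊛ θₜ R) n i) - ι 4 * R n i) + 2ℚ * (t⊛ R) n i
    ≡⟨ cong₂ (λ a b → ((ι 4 * a - b) - ι 4 * R n i) + 2ℚ * (t⊛ R) n i) (R⊛R≗Δ n i) 2R⊛θₜR≡θₜΔ ⟩
  ((ι 4 * Δ n i - θₜ Δ n i) - ι 4 * R n i) + 2ℚ * (t⊛ R) n i ∎
  where
  R⊛t≗tR : (R ⊛ t⊛ one) n i ≡ (t⊛ R) n i
  R⊛t≗tR = trans (⊛-homoʳ t⊛-multiplier R one n i) (≗-homo t⊛-multiplier (⊛-identityʳ R) n i)
  2R⊛θₜR≡θₜΔ : 2ℚ * (R ⊛ θₜ R) n i ≡ θₜ Δ n i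
  2R⊛θₜR≡θₜΔ = trans (sym (θ-⊛-square θₜ-additive R n i)) (cong (ι n *_) (R⊛R≗Δ n i))

gB-1-2[gA-1] : Series
gB-1-2[gA-1] = (gB ⊖ one) ⊖ 2ℚ · (gA ⊖ one)

gB-1-2[gA-1]≗θₜgA-θₓgA-gA+1 : gB-1-2[gA-1] ≗ ((θₜ gA ⊖ θₓ gA) ⊖ gA) ⊕ one
gB-1-2[gA-1]≗θₜgA-θₓgA-gA+1 n i = begin
  (gB n i - one n i) - 2ℚ * (gA n i - one n i)
    ≡⟨ cong (λ b → (b - one n i) - 2ℚ * (gA n i - one n i)) (gB≗θₜgA-θₓgA+gA n i) ⟩
  (((ι n * a - ι i * a) + a) - one n i) - 2ℚ * (a - one n i)
    ≡⟨ solve 4 (λ x y a o → (((x :* a :- y :* a) :+ a) :- o) :- con 2ℚ :* (a :- o) := ((x :* a :- y :* a) :- a) :+ o) refl (ι n) (ι i) a (one n i) ⟩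
  ((ι n * a - ι i * a) - a) + one n i ∎
  where a = gA n i

2Q⊛[gB-1-2[gA-1]] : 2ℚ · Q⊛ gB-1-2[gA-1] ≗ ((θₜ 1+t-R ⊖ θₓ 1+t-R) ⊖ 2ℚ · 1+t-R) ⊕ 2ℚ · Q⊛ one
2Q⊛[gB-1-2[gA-1]] n i = begin
  2ℚ * (Q⊛ gB-1-2[gA-1]) n i
    ≡⟨ cong (2ℚ *_) (≗-homo Q-multiplier gB-1-2[gA-1]≗θₜgA-θₓgA-gA+1 n i) ⟩
  2ℚ * (Q⊛ (((θₜ gA ⊖ θₓ gA) ⊖ gA) ⊕ one)) n i
    ≡⟨ cong (2ℚ *_) (trans (⊕-homo Q-multiplier _ one n i) (cong (_+ q) (trans (⊖-homo Q-multiplier (θₜ gA ⊖ θₓ gA) gA n i)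
         (cong (_- a) (⊖-homo Q-multiplier (θₜ gA) (θₓ gA) n i))))) ⟩
  2ℚ * ((((Q⊛ θₜ gA) n i - (Q⊛ θₓ gA) n i) - a) + q)
    ≡⟨ cong₂ (λ x y → 2ℚ * (((x - y) - a) + q)) (Q⊛θₜ gA n i) (Q⊛θₓ gA n i) ⟩
  2ℚ * ((((ι n * a - (s + 2ℚ * u)) - (ι i * a - u)) - a) + q)
    ≡⟨ solve 5 (λ x y s u q → con 2ℚ :* ((((x :* (s :+ u) :- (s :+ con 2ℚ :* u)) :- (y :* (s :+ u) :- u)) :- (s :+ u)) :+ q)
                             := ((x :* (con 2ℚ :* (s :+ u)) :- y :* (con 2ℚ :* (s :+ u))) :- con 2ℚ :* (con 2ℚ :* (s :+ u))) :+ con 2ℚ :* q)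
         refl (ι n) (ι i) s u q ⟩
  ((ι n * (2ℚ * a) - ι i * (2ℚ * a)) - 2ℚ * (2ℚ * a)) + 2ℚ * q
    ≡⟨ cong (λ z → ((ι n * z - ι i * z) - 2ℚ * z) + 2ℚ * q) (2Q⊛gA≗1+t-R n i) ⟩
  ((ι n * 1+t-R n i - ι i * 1+t-R n i) - 2ℚ * 1+t-R n i) + 2ℚ * q ∎
  where
  a = (Q⊛ gA) n i
  s = (t⊛ gA) n i
  u = (x⊛ t⊛ t⊛ gA) n i
  q = (Q⊛ one) n i

2Q⊛[gA⊛gD] : 2ℚ · Q⊛ (gA ⊛ gD) ≗ 1+t-R ⊛ gD
2Q⊛[gA⊛gD] n i = begin
  2ℚ * (Q⊛ (gA ⊛ gD)) n i   ≡⟨ cong (2ℚ *_) (⊛-homo Q-multiplier gA gD n i) ⟨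
  2ℚ * (Q⊛ gA ⊛ gD) n i     ≡⟨ ⊛-·ˡ 2ℚ (Q⊛ gA) gD n i ⟨
  ((2ℚ · Q⊛ gA) ⊛ gD) n i   ≡⟨ ⊛-congˡ gD 2Q⊛gA≗1+t-R n i ⟩
  (1+t-R ⊛ gD) n i          ∎

private
  vanishing : ∀ x y → ((((ι 4 * 0ℚ + ι 6 * 0ℚ) + 2ℚ * 0ℚ) - ι 4 * 0ℚ) + x * 0ℚ) - ι 4 * ((x - y) * (0ℚ + 0ℚ)) - ι 8 * 0ℚ ≡ 0ℚ
  vanishing = solve 2 (λ x y → ((((con (ι 4) :* con 0ℚ :+ con (ι 6) :* con 0ℚ) :+ con 2ℚ :* con 0ℚ) :- con (ι 4) :* con 0ℚ) :+ x :* con 0ℚ)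
                                :- con (ι 4) :* ((x :- y) :* (con 0ℚ :+ con 0ℚ)) :- con (ι 8) :* con 0ℚ := con 0ℚ) refl

polynomial-identity : ∀ n i →
  ((((ι 4 * one n i + ι 6 * (t⊛ one) n i) + 2ℚ * (t⊛ t⊛ one) n i) - ι 4 * Δ n i) + θₜ Δ n i)
    - ι 4 * ((ι n - ι i) * (one n i + (t⊛ one) n i)) - ι 8 * (Q⊛ one) n i ≡ 0ℚ
polynomial-identity zero                zero          = refl
polynomial-identity zero                (suc zero)    = refl
polynomial-identity zero                (suc (suc k)) = vanishing (ι 0) (ι (suc (suc k)))
polynomial-identity (suc zero)          zero          = refl
polynomial-identity (suc zero)          (suc zero)    = refl
polynomial-identity (suc zero)          (suc (suc k)) = vanishing (ι 1) (ι (suc (suc k)))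
polynomial-identity (suc (suc zero))    zero          = refl
polynomial-identity (suc (suc zero))    (suc zero)    = refl
polynomial-identity (suc (suc zero))    (suc (suc k)) = vanishing (ι 2) (ι (suc (suc k)))
polynomial-identity (suc (suc (suc m))) zero          = vanishing (ι (3 ℕ.+ m)) (ι 0)
polynomial-identity (suc (suc (suc m))) (suc k)       = vanishing (ι (3 ℕ.+ m)) (ι (suc k))

8Q⊛[gA⊛gD]-via-R : ∀ n i → ι 8 * (Q⊛ (gA ⊛ gD)) n i
                   ≡ 2ℚ * (2R-θₜR-[2-t] n i + (t⊛ 2R-θₜR-[2-t]) n i) - (((ι 4 * Δ n i - θₜ Δ n i) - ι 4 * R n i) + 2ℚ * (t⊛ R) n i)
8Q⊛[gA⊛gD]-via-R n i = begin
  ι 8 * w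
    ≡⟨ solve 1 (λ w → con (ι 8) :* w := con 2ℚ :* (con 2ℚ :* (con 2ℚ :* w))) refl w ⟩
  2ℚ * (2ℚ * (2ℚ * w))
    ≡⟨ cong (λ z → 2ℚ * (2ℚ * z)) (2Q⊛[gA⊛gD] n i) ⟩
  2ℚ * (2ℚ * (1+t-R ⊛ gD) n i)
    ≡⟨ cong (2ℚ *_) (trans (sym (⊛-·ʳ 2ℚ 1+t-R gD n i)) (⊛-congʳ 1+t-R 2gD≗2R-θₜR-[2-t] n i)) ⟩
  2ℚ * (1+t-R ⊛ X) n i
    ≡⟨ cong (2ℚ *_) (1+t-R⊛ X n i) ⟩
  2ℚ * ((X n i + (t⊛ X) n i) - (R ⊛ X) n i)
    ≡⟨ solve 3 (λ a b c → con 2ℚ :* ((a :+ b) :- c) := con 2ℚ :* (a :+ b) :- con 2ℚ :* c) refl (X n i) ((t⊛ X) n i) ((R ⊛ X) n i) ⟩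
  2ℚ * (X n i + (t⊛ X) n i) - 2ℚ * (R ⊛ X) n i
    ≡⟨ cong (λ z → 2ℚ * (X n i + (t⊛ X) n i) - z) (2R⊛[2R-θₜR-[2-t]] n i) ⟩
  2ℚ * (X n i + (t⊛ X) n i) - (((ι 4 * Δ n i - θₜ Δ n i) - ι 4 * R n i) + 2ℚ * (t⊛ R) n i) ∎
  where
  X = 2R-θₜR-[2-t]
  w = (Q⊛ (gA ⊛ gD)) n i

8Q⊛[gA⊛gD]≡8Q⊛[gB-1-2[gA-1]] : ∀ n i → ι 8 * (Q⊛ (gA ⊛ gD)) n i ≡ ι 8 * (Q⊛ gB-1-2[gA-1]) n i
8Q⊛[gA⊛gD]≡8Q⊛[gB-1-2[gA-1]] n i = begin
  ι 8 * (Q⊛ (gA ⊛ gD)) n i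
    ≡⟨ 8Q⊛[gA⊛gD]-via-R n i ⟩
  2ℚ * (X n i + (t⊛ X) n i) - (((ι 4 * δ - ι n * δ) - ι 4 * r) + 2ℚ * sr)
    ≡⟨ cong (λ z → 2ℚ * (X n i + z) - (((ι 4 * δ - ι n * δ) - ι 4 * r) + 2ℚ * sr)) t⊛X ⟩
  2ℚ * (X n i + tX) - (((ι 4 * δ - ι n * δ) - ι 4 * r) + 2ℚ * sr)
    -- the terms in R cancel against 4·(2Q⊛[gB-1-2[gA-1]]) up to [1-t]θₜR+tR≗2θₓR; the rest is polynomial-identity
    ≡⟨ solve 10 (λ x y r sr st o to tto δ q →
         con 2ℚ :* (((con 2ℚ :* r :- x :* r) :- (con 2ℚ :* o :- to)) :+ ((con 2ℚ :* sr :- st) :- (con 2ℚ :* to :- tto)))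
           :- (((con (ι 4) :* δ :- x :* δ) :- con (ι 4) :* r) :+ con 2ℚ :* sr)
         := con (ι 4) :* (((x :* ((o :+ to) :- r) :- y :* ((o :+ to) :- r)) :- con 2ℚ :* ((o :+ to) :- r)) :+ con 2ℚ :* q)
            :+ con 2ℚ :* (((x :* r :- st) :+ sr) :- con 2ℚ :* (y :* r))
            :+ (((((con (ι 4) :* o :+ con (ι 6) :* to) :+ con 2ℚ :* tto) :- con (ι 4) :* δ) :+ x :* δ)
                 :- con (ι 4) :* ((x :- y) :* (o :+ to)) :- con (ι 8) :* q))
         refl (ι n) (ι i) r sr st o to tto δ q ⟩
  ι 4 * E₂ + 2ℚ * (((ι n * r - st) + sr) - 2ℚ * (ι i * r)) + κ
    ≡⟨ cong₂ (λ a b → ι 4 * E₂ + 2ℚ * (a - 2ℚ * (ι i * r)) + b) ([1-t]θₜR+tR≗2θₓR n i) (polynomial-identity n i) ⟩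
  ι 4 * E₂ + 2ℚ * (2ℚ * (ι i * r) - 2ℚ * (ι i * r)) + 0ℚ
    ≡⟨ solve 2 (λ e a → con (ι 4) :* e :+ con 2ℚ :* (con 2ℚ :* a :- con 2ℚ :* a) :+ con 0ℚ := con (ι 4) :* e) refl E₂ (ι i * r) ⟩
  ι 4 * E₂
    ≡⟨ cong (ι 4 *_) (2Q⊛[gB-1-2[gA-1]] n i) ⟨
  ι 4 * (2ℚ * e)
    ≡⟨ solve 1 (λ e → con (ι 4) :* (con 2ℚ :* e) := con (ι 8) :* e) refl e ⟩
  ι 8 * e ∎
  where
  X = 2R-θₜR-[2-t]
  e = (Q⊛ gB-1-2[gA-1]) n i
  r = R n i
  sr = (t⊛ R) n i
  st = (t⊛ θₜ R) n i
  o = one n i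
  to = (t⊛ one) n i
  tto = (t⊛ t⊛ one) n i
  δ = Δ n i
  q = (Q⊛ one) n i
  tX = (2ℚ * sr - st) - (2ℚ * to - tto)
  N = 1+t-R n i
  E₂ = ((ι n * N - ι i * N) - 2ℚ * N) + 2ℚ * q
  κ = ((((ι 4 * o + ι 6 * to) + 2ℚ * tto) - ι 4 * δ) + θₜ Δ n i) - ι 4 * ((ι n - ι i) * (o + to)) - ι 8 * q
  t⊛X : (t⊛ X) n i ≡ tX
  t⊛X = begin
    (t⊛ X) n i                                                ≡⟨ ⊖-homo t⊛-multiplier (2ℚ · R ⊖ θₜ R) (2ℚ · one ⊖ t⊛ one) n i ⟩
    (t⊛ (2ℚ · R ⊖ θₜ R)) n i - (t⊛ (2ℚ · one ⊖ t⊛ one)) n i  ≡⟨ cong₂ _-_ (⊖-homo t⊛-multiplier (2ℚ · R) (θₜ R) n i)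
                                                                           (⊖-homo t⊛-multiplier (2ℚ · one) (t⊛ one) n i) ⟩
    ((t⊛ (2ℚ · R)) n i - st) - ((t⊛ (2ℚ · one)) n i - tto)    ≡⟨ cong₂ (λ a b → (a - st) - (b - tto)) (·-homo t⊛-multiplier 2ℚ R n i)
                                                                           (·-homo t⊛-multiplier 2ℚ one n i) ⟩
    tX                                                        ∎

gA⊛gD≗gB-1-2[gA-1] : gA ⊛ gD ≗ gB-1-2[gA-1]
gA⊛gD≗gB-1-2[gA-1] n i = begin
  (gA ⊛ gD) n i                                 ≡⟨ solve 2 (λ w e → w := (w :- e) :+ e) refl ((gA ⊛ gD) n i) (gB-1-2[gA-1] n i) ⟩
  (gA ⊛ gD ⊖ gB-1-2[gA-1]) n i + gB-1-2[gA-1] n i ≡⟨ cong (_+ gB-1-2[gA-1] n i) (Q⊛-injective (gA ⊛ gD ⊖ gB-1-2[gA-1]) Q⊛-difference≡0 n i) ⟩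
  0ℚ + gB-1-2[gA-1] n i                         ≡⟨ +-identityˡ (gB-1-2[gA-1] n i) ⟩
  gB-1-2[gA-1] n i                              ∎
  where
  Q⊛-difference≡0 : ∀ n i → (Q⊛ (gA ⊛ gD ⊖ gB-1-2[gA-1])) n i ≡ 0ℚ
  Q⊛-difference≡0 n i = ι[1+d]*x≡0⇒x≡0 7 (begin
    ι 8 * (Q⊛ (gA ⊛ gD ⊖ gB-1-2[gA-1])) n i  ≡⟨ cong (ι 8 *_) (⊖-homo Q-multiplier (gA ⊛ gD) gB-1-2[gA-1] n i) ⟩
    ι 8 * (w - e)                            ≡⟨ solve 2 (λ w e → con (ι 8) :* (w :- e) := con (ι 8) :* w :- con (ι 8) :* e) refl w e ⟩
    ι 8 * w - ι 8 * e                        ≡⟨ cong (_- ι 8 * e) (8Q⊛[gA⊛gD]≡8Q⊛[gB-1-2[gA-1]] n i) ⟩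
    ι 8 * e - ι 8 * e                        ≡⟨ +-inverseʳ (ι 8 * e) ⟩
    0ℚ                                       ∎)
    where
    w = (Q⊛ (gA ⊛ gD)) n i
    e = (Q⊛ gB-1-2[gA-1]) n i

lemma1 : (n i : ℕ) → (gB ⊖ one) n i ≡ (2ℚ · (gA ⊖ one) ⊕ gA ⊛ gD) n i
lemma1 n i = begin
  gB n i - one n i                              ≡⟨ solve 3 (λ b o a → b :- o
                                                             := con 2ℚ :* (a :- o) :+ ((b :- o) :- con 2ℚ :* (a :- o))) refl (gB n i) (one n i) (gA n i) ⟩
  2ℚ * (gA n i - one n i) + gB-1-2[gA-1] n i    ≡⟨ cong (λ z → 2ℚ * (gA n i - one n i) + z) (gA⊛gD≗gB-1-2[gA-1] n i) ⟨
  2ℚ * (gA n i - one n i) + (gA ⊛ gD) n i       ∎
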